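{- Let $r$ and $s$ be positive integers with $r \geq s \geq 3$ and $\gcd(r,s)=1$. If $r \leq 2s - 2$, then $f(s,r,\mathbb{Z}) = 6s - 4$.
   Context: For integers $a\le b$, $[a,b]=\{n\in\mathbb{N} : a\le n\le b\}$. For a finite set $X\subseteq\mathbb{N}$, $\mathrm{diam}(X)=\max(X)-\min(X)$. Given a coloring $\Delta:[1,n]\to\mathbb{Z}$, a subset $Y$ is zero-sum mod $m$ if $\sum_{y\in Y}\Delta(y)\equiv 0 \pmod m$. $f(s,r,\mathbb{Z})$ denotes the smallest positive integer $n$ such that for every coloring $\Delta:[1,n]\to\mathbb{Z}$ there exist subsets $S_1,S_2\subseteq[1,n]$ with: (a) $S_1$ zero-sum mod $s$ and $S_2$ zero-sum mod $r$; (b) $|S_1|=s$, $|S_2|=r$; (c) $\max(S_1)<\min(S_2)$; (d) $\mathrm{diam}(S_1)\le\mathrm{diam}(S_2)$. -}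

module Defs where

open import Data.Nat using (ℕ; zero; suc; _≤_; _<_; _∸_)
open import Data.Integer using (ℤ; +_) renaming (_+_ to _+ℤ_)
open import Data.Integer.Divisibility using (_∣_)
open import Data.List using (List; []; _∷_; length)
open import Data.List.Relation.Unary.All using (All)
open import Data.List.Relation.Unary.Linked using (Linked)
open import Data.Product using (Σ; _×_; _,_)
open import Relation.Binary.PropositionalEquality using (_≡_)
open import Relation.Nullary using (¬_)

-- A finite subset of ℕ is represented as a strictly increasing list of its elements.
-- Minimum = first element, maximum = last element (defaults 0 only for the empty list,
-- which never occurs below since sizes are ≥ 3).
minL : List ℕ → ℕ
minL []      = 0
minL (x ∷ _) = x

maxL : List ℕ → ℕ
maxL []           = 0
maxL (x ∷ [])     = x
maxL (_ ∷ y ∷ ys) = maxL (y ∷ ys)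

diam : List ℕ → ℕ
diam xs = maxL xs ∸ minL xs

IsSubsetOf[1,_] : ℕ → List ℕ → Set
IsSubsetOf[1, n ] xs = Linked _<_ xs × All (λ x → 1 ≤ x × x ≤ n) xs

sumΔ : (ℕ → ℤ) → List ℕ → ℤ
sumΔ Δ []       = + 0
sumΔ Δ (y ∷ ys) = Δ y +ℤ sumΔ Δ ys

ZeroSumMod : (ℕ → ℤ) → ℕ → List ℕ → Set
ZeroSumMod Δ m ys = (+ m) ∣ sumΔ Δ ys

-- The property defining f(s,r,ℤ) at n: every colouring Δ : [1,n] → ℤ
-- (represented as ℕ → ℤ; values outside [1,n] are irrelevant) admits S₁, S₂ with (a)-(d).
Good : ℕ → ℕ → ℕ → Set
Good s r n =
  (Δ : ℕ → ℤ) →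
  Σ (List ℕ) λ S₁ → Σ (List ℕ) λ S₂ →
    IsSubsetOf[1, n ] S₁ × IsSubsetOf[1, n ] S₂ ×
    ZeroSumMod Δ s S₁ × ZeroSumMod Δ r S₂ ×
    length S₁ ≡ s × length S₂ ≡ r ×
    maxL S₁ < minL S₂ ×
    diam S₁ ≤ diam S₂

fZ≡ : ℕ → ℕ → ℕ → Set
fZ≡ s r v = 1 ≤ v × Good s r v × ((n : ℕ) → 1 ≤ n → n < v → ¬ Good s r n)

{-# OPTIONS --safe #-}
-- By the Erdős–Ginzburg–Ziv theorem, any 2m − 1 integers contain m whose sum is
-- divisible by m.  (For a prime p, sort 2p − 1 weights by residue, set the first one aside and
-- pair the i-th of the remaining 2p − 2 with the (i + p − 1)-th.  If some pair agrees mod p, the p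
-- weights sorted between them all agree.  Otherwise adding one element of each pair to the first
-- weight reaches at least one new residue per pair, by a Cauchy–Davenport argument, so it
-- reaches 0.  Composite moduli follow multiplicatively.)  Take S₁ among 1, …, 2s − 1, so
-- diam S₁ ≤ 2s − 2, and S₂ among the 2r − 1 numbers φ j = 2s + j + c[j ≥ 1] + c[j ≥ r] with
-- c = 2s − 1 − r.  Whichever r indices are chosen, S₂ spans one of the two jumps of length c,
-- so diam S₂ ≥ 2s − 2.  All of this fits in [1, 6s − 4].
--
-- Colour [s, 2s − 2] and [3s − 2, 4s − 4] with r, [4s − 2, 6s − 5] with s and the
-- rest of [1, 6s − 5] with 0.  Since gcd(r, s) = 1, S₁ has 0 or s elements coloured r, and S₂ has
-- 0 or r elements coloured s.  In every case either S₁ meets two stretches separated by s − 1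
-- consecutive numbers, so diam S₁ ≥ 2s − 2, which no S₂ placed to its right can match, or S₂
-- would have to pass 6s − 5.
module Submission where

open import Defs
open import Data.Bool using (Bool; true; false; _∨_; _∧_; not)
open import Data.Bool.Properties using (∨-zeroʳ; T-≡)
open import Data.Empty using (⊥; ⊥-elim)
open import Data.Integer using (ℤ) renaming (_+_ to _+ℤ_; _*_ to _*ℤ_)
import Data.Integer as ℤ
open import Data.Integer.DivMod using (_%ℕ_; _/ℕ_; a≡a%ℕn+[a/ℕn]*n)
import Data.Integer.Divisibility as ℤ∣
import Data.Integer.Divisibility.Signed as Signed
open import Data.Integer.Properties using (pos-+)
import Data.Integer.Tactic.RingSolver as ℤ-Solver
open import Data.List using (List; []; _∷_; _++_; [_]; length; map; concatMap; upTo)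
open import Data.List.Membership.Propositional using (_∈_)
open import Data.List.Properties using (++-assoc; ++-identityʳ; length-++; length-map; length-upTo; concatMap-++; map-++)
open import Data.List.Relation.Binary.Permutation.Propositional
  using (_↭_; prep; swap; ↭-refl; ↭-sym; ↭-trans; ↭-reflexive; ↭⇒↭ₛ)
import Data.List.Relation.Binary.Permutation.Propositional as ↭
open import Data.List.Relation.Binary.Permutation.Propositional.Properties
  using (shift; shifts; ∷↭∷ʳ; ++⁺ˡ; ++⁺ʳ; map⁺; All-resp-↭; ↭-length)
import Data.List.Relation.Binary.Permutation.Setoid.Properties as ↭ₛ
open import Data.List.Relation.Unary.All as All using (All; []; _∷_)
open import Data.List.Relation.Unary.All.Properties using (++⁻ˡ; ++⁻ʳ; all-upTo)
import Data.List.Relation.Unary.All.Properties as Allₚ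
open import Data.List.Relation.Unary.AllPairs as AllPairs using (AllPairs; []; _∷_)
open import Data.List.Relation.Unary.Any using (here; there)
open import Data.List.Relation.Unary.Linked as Linked using (Linked; []; [-]; _∷_)
import Data.List.Relation.Unary.Linked.Properties as Linked
open import Data.List.Relation.Unary.Unique.Propositional using (Unique)
open import Data.List.Relation.Unary.Unique.Propositional.Properties using (upTo⁺)
import Data.List.Sort as Sort
open import Data.Nat
open import Data.Nat.Coprimality using (Coprime; coprime-divisor; prime⇒coprime; coprime-Bézout; gcd≡1⇒coprime)
import Data.Nat.Coprimality as Coprimality
open import Data.Nat.DivMod
open import Data.Nat.Divisibility using (_∣_; 1∣_; divides; m%n≡0⇒n∣m; *-monoˡ-∣; ∣m+n∣m⇒∣n; m∣m*n)
open import Data.Nat.GCD using (gcd; module Bézout)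
open import Data.Nat.ListAction using (sum; product)
open import Data.Nat.ListAction.Properties using (sum-++; sum-↭)
open import Data.Nat.Primality using (Prime; prime⇒nonZero; productOfPrimes≢0)
open import Data.Nat.Primality.Factorisation using (factorise; PrimeFactorisation)
open import Data.Nat.Properties
open import Data.Nat.Tactic.RingSolver using (solve-∀)
open import Data.Product using (∃; ∃₂; _×_; _,_; proj₁; proj₂)
open import Data.Sum using (_⊎_; inj₁; inj₂; [_,_]′)
open import Function using (_∘_; _on_; case_of_)
open import Function.Bundles using (Equivalence)
import Relation.Binary.Construct.On as On
open import Relation.Binary.PropositionalEquality hiding ([_])
open import Relation.Nullary using (¬_; yes; no; contradiction)

-- Counting and shifting sets of residues

bit : Bool → ℕ
bit true  = 1
bit false = 0

count : (ℕ → Bool) → ℕ → ℕ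
count S zero    = 0
count S (suc k) = bit (S k) + count S k

search : ∀ (S : ℕ → Bool) k → (∃ λ z → z < k × S z ≡ true) ⊎ (∀ z → z < k → S z ≡ false)
search S zero = inj₂ (λ _ ())
search S (suc k) with S k in Sk | search S k
... | true  | _                    = inj₁ (k , ≤-refl , Sk)
... | false | inj₁ (z , z<k , Sz)  = inj₁ (z , m<n⇒m<1+n z<k , Sz)
... | false | inj₂ none            = inj₂ λ z z<1+k → case (m<1+n⇒m<n∨m≡n z<1+k) of λ where
  (inj₁ z<k) → none z z<k
  (inj₂ refl) → Sk

bit-mono : ∀ {a b} → (a ≡ true → b ≡ true) → bit a ≤ bit b
bit-mono {false} _   = z≤n
bit-mono {true}  a⇒b rewrite a⇒b refl = ≤-refl

module _ {S T : ℕ → Bool} where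

  count-cong : ∀ k → (∀ u → u < k → S u ≡ T u) → count S k ≡ count T k
  count-cong zero    _   = refl
  count-cong (suc k) S≡T =
    cong₂ _+_ (cong bit (S≡T k ≤-refl)) (count-cong k λ u u<k → S≡T u (m<n⇒m<1+n u<k))

  count-mono : ∀ k → (∀ u → u < k → S u ≡ true → T u ≡ true) → count S k ≤ count T k
  count-mono zero    _   = z≤n
  count-mono (suc k) S⊆T =
    +-mono-≤ (bit-mono (S⊆T k ≤-refl)) (count-mono k λ u u<k → S⊆T u (m<n⇒m<1+n u<k))

  count-mono-< : ∀ k → (∀ u → u < k → S u ≡ true → T u ≡ true) →
                 ∀ u → u < k → S u ≡ false → T u ≡ true → count S k < count T k
  count-mono-< (suc k) S⊆T u u<1+k Su Tu with m<1+n⇒m<n∨m≡n u<1+k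
  ... | inj₁ u<k  = +-mono-≤-< (bit-mono (S⊆T k ≤-refl))
                               (count-mono-< k (λ v v<k → S⊆T v (m<n⇒m<1+n v<k)) u u<k Su Tu)
  ... | inj₂ refl rewrite Su | Tu = s≤s (count-mono k λ v v<k → S⊆T v (m<n⇒m<1+n v<k))

count-true : ∀ k → count (λ _ → true) k ≡ k
count-true zero    = refl
count-true (suc k) = cong suc (count-true k)

count-false : ∀ k → count (λ _ → false) k ≡ 0
count-false zero    = refl
count-false (suc k) = count-false k

module _ {S : ℕ → Bool} where

  count-all : ∀ k → (∀ u → u < k → S u ≡ true) → count S k ≡ k
  count-all k all = trans (count-cong {T = λ _ → true} k all) (count-true k)

  count-member⁻¹ : ∀ k → 1 ≤ count S k → ∃ λ u → u < k × S u ≡ true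
  count-member⁻¹ k nonempty with search S k
  ... | inj₁ member = member
  ... | inj₂ none   = contradiction (trans (count-cong {T = λ _ → false} k none) (count-false k)) (>⇒≢ nonempty)

  count-full : ∀ k → k ≤ count S k → ∀ u → u < k → S u ≡ true
  count-full k k≤count u u<k with S u in Su
  ... | true  = refl
  ... | false = ⊥-elim (<⇒≱ (count-mono-< {T = λ _ → true} k (λ _ _ _ → refl) u u<k Su refl)
                            (≤-trans (≤-reflexive (count-true k)) k≤count))

  count-member : ∀ k u → u < k → S u ≡ true → 1 ≤ count S k
  count-member k u u<k Su = subst (_< count S k) (count-false k)
                                  (count-mono-< {S = λ _ → false} k (λ _ _ ()) u u<k refl Su)

  count-suc-shift : ∀ k → count S (suc k) ≡ count (S ∘ suc) k + bit (S 0)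
  count-suc-shift zero    = +-comm (bit (S 0)) 0
  count-suc-shift (suc k) = trans (cong (bit (S (suc k)) +_) (count-suc-shift k)) (sym (+-assoc (bit (S (suc k))) _ _))

count-rotate₁ : ∀ n (S : ℕ → Bool) → count (λ u → S ((u + 1) % suc n)) (suc n) ≡ count S (suc n)
count-rotate₁ n S = begin
  bit (S ((n + 1) % suc n)) + count (λ u → S ((u + 1) % suc n)) n
    ≡⟨ cong₂ _+_ (cong (bit ∘ S) (trans (cong (_% suc n) (+-comm n 1)) (n%n≡0 (suc n))))
                 (count-cong n λ u u<n → cong S (trans (cong (_% suc n) (+-comm u 1)) (m<n⇒m%n≡m (s≤s u<n)))) ⟩
  bit (S 0) + count (S ∘ suc) n ≡⟨ +-comm (bit (S 0)) _ ⟩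
  count (S ∘ suc) n + bit (S 0) ≡⟨ count-suc-shift n ⟨
  count S (suc n) ∎
  where open ≡-Reasoning

count-rotate : ∀ p .{{_ : NonZero p}} (S : ℕ → Bool) c → count (λ u → S ((u + c) % p)) p ≡ count S p
count-rotate (suc n) S zero =
  count-cong (suc n) λ u u<p → cong S (trans (cong (_% suc n) (+-identityʳ u)) (m<n⇒m%n≡m u<p))
count-rotate (suc n) S (suc c) = begin
  count (λ u → S ((u + suc c) % suc n)) (suc n)
    ≡⟨ count-cong (suc n) (λ u _ → cong S (regroup u)) ⟩
  count (λ u → S (((u + 1) % suc n + c) % suc n)) (suc n)
    ≡⟨ count-rotate₁ n (λ u → S ((u + c) % suc n)) ⟩
  count (λ u → S ((u + c) % suc n)) (suc n)
    ≡⟨ count-rotate (suc n) S c ⟩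
  count S (suc n) ∎
  where
  open ≡-Reasoning
  regroup : ∀ u → (u + suc c) % suc n ≡ ((u + 1) % suc n + c) % suc n
  regroup u = begin
    (u + suc c) % suc n       ≡⟨ cong (_% suc n) (sym (+-assoc u 1 c)) ⟩
    (u + 1 + c) % suc n       ≡⟨ %-distribˡ-+ (u + 1) c (suc n) ⟩
    ((u + 1) % suc n + c % suc n) % suc n ≡⟨ cong (λ x → (x + c % suc n) % suc n) (m%n%n≡m%n (u + 1) (suc n)) ⟨
    ((u + 1) % suc n % suc n + c % suc n) % suc n ≡⟨ %-distribˡ-+ ((u + 1) % suc n) c (suc n) ⟨
    ((u + 1) % suc n + c) % suc n ∎

module Residues (p : ℕ) .{{_ : NonZero p}} where

  infix 4 _≈_
  _≈_ : ℕ → ℕ → Set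
  a ≈ b = a % p ≡ b % p

  +-cong : ∀ {a b c d} → a ≈ b → c ≈ d → a + c ≈ b + d
  +-cong {a} {b} {c} {d} a≈b c≈d = begin
    (a + c) % p               ≡⟨ %-distribˡ-+ a c p ⟩
    (a % p + c % p) % p       ≡⟨ cong₂ (λ x y → (x + y) % p) a≈b c≈d ⟩
    (b % p + d % p) % p       ≡⟨ %-distribˡ-+ b d p ⟨
    (b + d) % p               ∎
    where open ≡-Reasoning

  *-cong : ∀ {a b c d} → a ≈ b → c ≈ d → a * c ≈ b * d
  *-cong {a} {b} {c} {d} a≈b c≈d = begin
    (a * c) % p               ≡⟨ %-distribˡ-* a c p ⟩
    (a % p * (c % p)) % p     ≡⟨ cong₂ (λ x y → (x * y) % p) a≈b c≈d ⟩
    (b % p * (d % p)) % p     ≡⟨ %-distribˡ-* b d p ⟨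
    (b * d) % p               ∎
    where open ≡-Reasoning

  %-≈ : ∀ a → a % p ≈ a
  %-≈ a = m%n%n≡m%n a p

  0%p≡0 : 0 % p ≡ 0
  0%p≡0 = m<n⇒m%n≡m (>-nonZero⁻¹ p)

  neg : ℕ → ℕ
  neg a = p ∸ a % p

  +-neg : ∀ a → a + neg a ≈ 0
  +-neg a = begin
    (a + neg a) % p           ≡⟨ +-cong {a % p} (%-≈ a) refl ⟨
    (a % p + neg a) % p       ≡⟨ cong (_% p) (m+[n∸m]≡n (m%n≤n a p)) ⟩
    p % p                     ≡⟨ n%n≡0 p ⟩
    0                         ≡⟨ 0%p≡0 ⟨
    0 % p                     ∎
    where open ≡-Reasoning

  +-neg-cancel : ∀ a b → a + b + neg b ≈ a
  +-neg-cancel a b = begin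
    (a + b + neg b) % p       ≡⟨ cong (_% p) (+-assoc a b (neg b)) ⟩
    (a + (b + neg b)) % p     ≡⟨ +-cong {a} refl (+-neg b) ⟩
    (a + 0) % p               ≡⟨ cong (_% p) (+-identityʳ a) ⟩
    a % p                     ∎
    where open ≡-Reasoning

  +-cancelʳ : ∀ a b c → a + c ≈ b + c → a ≈ b
  +-cancelʳ a b c a+c≈b+c = begin
    a % p                     ≡⟨ +-neg-cancel a c ⟨
    (a + c + neg c) % p       ≡⟨ +-cong {a + c} a+c≈b+c refl ⟩
    (b + c + neg c) % p       ≡⟨ +-neg-cancel b c ⟩
    b % p                     ∎
    where open ≡-Reasoning

  Full : (ℕ → Bool) → Set
  Full S = ∀ v → v < p → S v ≡ true

  infixl 6 _⊕_ _⊖_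

  _⊕_ : ℕ → ℕ → ℕ
  a ⊕ b = (a + b) % p

  _⊖_ : ℕ → ℕ → ℕ
  a ⊖ b = a ⊕ neg b

  ⊕-< : ∀ a b → a ⊕ b < p
  ⊕-< a b = m%n<n (a + b) p

  ⊕-assoc : ∀ a b c → a ⊕ b ⊕ c ≡ a ⊕ (b + c)
  ⊕-assoc a b c = trans (+-cong {(a + b) % p} (%-≈ (a + b)) refl) (cong (_% p) (+-assoc a b c))

  ⊕-⊖ : ∀ v x → v < p → v ⊕ x ⊖ x ≡ v
  ⊕-⊖ v x v<p = trans (⊕-assoc v x (neg x)) (trans (cong (_% p) (sym (+-assoc v x (neg x))))
                  (trans (+-neg-cancel v x) (m<n⇒m%n≡m v<p)))

  ⊖-⊕ : ∀ v x → v < p → v ⊖ x ⊕ x ≡ v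
  ⊖-⊕ v x v<p = begin
    v ⊖ x ⊕ x                 ≡⟨ ⊕-assoc v (neg x) x ⟩
    (v + (neg x + x)) % p     ≡⟨ cong (λ y → (v + y) % p) (+-comm (neg x) x) ⟩
    (v + (x + neg x)) % p     ≡⟨ +-cong {v} refl (+-neg x) ⟩
    (v + 0) % p               ≡⟨ cong (_% p) (+-identityʳ v) ⟩
    v % p                     ≡⟨ m<n⇒m%n≡m v<p ⟩
    v                         ∎
    where open ≡-Reasoning

  module _ (p-prime : Prime p) where

    inverse : ∀ d → d % p ≢ 0 → ∃ λ e → e * d ≈ 1
    inverse d d≢0 with coprime-Bézout (prime⇒coprime p-prime {{≢-nonZero d≢0}} (m%n<n d p))
    ... | Bézout.-+ x y 1+xp≡yr = y , (begin
      (y * d) % p               ≡⟨ *-cong {y} refl (sym (%-≈ d)) ⟩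
      (y * (d % p)) % p         ≡⟨ cong (_% p) 1+xp≡yr ⟨
      (1 + x * p) % p           ≡⟨ [m+kn]%n≡m%n 1 x p ⟩
      1 % p                     ∎)
      where open ≡-Reasoning
    -- Here y · (d mod p) ≡ −1, so (p − 1) · y is an inverse.
    ... | Bézout.+- x y 1+yr≡xp = q * y , +-cancelʳ (q * y * d) 1 q (begin
      (q * y * d + q) % p       ≡⟨ +-cong (*-cong {q * y} refl (sym (%-≈ d))) refl ⟩
      (q * y * r + q) % p       ≡⟨ cong (_% p) (q*[1+yr] q y r) ⟩
      (q * (1 + y * r)) % p     ≡⟨ cong (λ z → (q * z) % p) 1+yr≡xp ⟩
      (q * (x * p)) % p         ≡⟨ cong (_% p) (sym (*-assoc q x p)) ⟩
      (q * x * p) % p           ≡⟨ m*n%n≡0 (q * x) p ⟩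
      0                         ≡⟨ n%n≡0 p ⟨
      p % p                     ≡⟨ cong (_% p) (suc-pred p) ⟨
      (1 + q) % p               ∎)
      where
      open ≡-Reasoning
      q r : ℕ
      q = pred p
      r = d % p
      q*[1+yr] : ∀ q y r → q * y * r + q ≡ q * (1 + y * r)
      q*[1+yr] = solve-∀

    shift-closed⇒full : ∀ (S : ℕ → Bool) d → d % p ≢ 0 →
                        (∀ z → z < p → S z ≡ true → S (z ⊕ d) ≡ true) →
                        ∀ z₀ → z₀ < p → S z₀ ≡ true → Full S
    shift-closed⇒full S d d≢0 closed z₀ z₀<p Sz₀ v v<p = subst (λ x → S x ≡ true) hits (orbit (e * w))
      where
      orbit : ∀ j → S (z₀ ⊕ j * d) ≡ true
      orbit zero    = trans (cong S (trans (cong (_% p) (+-identityʳ z₀)) (m<n⇒m%n≡m z₀<p))) Sz₀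
      orbit (suc j) = subst (λ x → S x ≡ true) next (closed (z₀ ⊕ j * d) (⊕-< z₀ (j * d)) (orbit j))
        where
        next : z₀ ⊕ j * d ⊕ d ≡ z₀ ⊕ suc j * d
        next = trans (⊕-assoc z₀ (j * d) d) (cong (λ x → (z₀ + x) % p) (+-comm (j * d) d))
      e w : ℕ
      e = proj₁ (inverse d d≢0)
      w = v + neg z₀
      e*w*d≡w*[e*d] : ∀ e w d → e * w * d ≡ w * (e * d)
      e*w*d≡w*[e*d] = solve-∀
      hits : z₀ ⊕ e * w * d ≡ v
      hits = begin
        (z₀ + e * w * d) % p       ≡⟨ cong (λ x → (z₀ + x) % p) (e*w*d≡w*[e*d] e w d) ⟩
        (z₀ + w * (e * d)) % p     ≡⟨ +-cong {z₀} refl (*-cong {w} refl (proj₂ (inverse d d≢0))) ⟩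
        (z₀ + w * 1) % p           ≡⟨ cong (λ x → (z₀ + x) % p) (trans (*-identityʳ w) (+-comm v (neg z₀))) ⟩
        (z₀ + (neg z₀ + v)) % p    ≡⟨ ⊕-assoc z₀ (neg z₀) v ⟨
        z₀ ⊖ z₀ ⊕ v                ≡⟨ cong (_⊕ v) (trans (+-neg z₀) 0%p≡0) ⟩
        v % p                      ≡⟨ m<n⇒m%n≡m v<p ⟩
        v                          ∎
        where open ≡-Reasoning

    shift-escape : ∀ (S : ℕ → Bool) d → d % p ≢ 0 → 1 ≤ count S p → count S p < p →
                   ∃ λ z → z < p × S z ≡ true × S (z ⊕ d) ≡ false
    shift-escape S d d≢0 nonempty proper with search (λ z → S z ∧ not (S (z ⊕ d))) p | count-member⁻¹ p nonempty
    ... | inj₁ (z , z<p , escapes) | _ = z , z<p , ∧-not-true escapes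
      where
      ∧-not-true : ∀ {a b} → a ∧ not b ≡ true → a ≡ true × b ≡ false
      ∧-not-true {true} {false} _ = refl , refl
    ... | inj₂ stays | z₀ , z₀<p , Sz₀ =
      contradiction (count-all p (shift-closed⇒full S d d≢0 closed z₀ z₀<p Sz₀)) (<⇒≢ proper)
      where
      ∧-not-false : ∀ {a b} → a ∧ not b ≡ false → a ≡ true → b ≡ true
      ∧-not-false {b = true}  _  _ = refl
      ∧-not-false {true} {false} () _
      closed : ∀ z → z < p → S z ≡ true → S (z ⊕ d) ≡ true
      closed z z<p = ∧-not-false (stays z z<p)

  ≢⇒⊖≢0 : ∀ a b → a % p ≢ b % p → b ⊖ a ≢ 0
  ≢⇒⊖≢0 a b a≢b b⊖a≡0 =
    a≢b (sym (+-cancelʳ b a (neg a) (trans b⊖a≡0 (trans (sym 0%p≡0) (sym (+-neg a))))))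

-- Sums of one element from each pair

flatten : ∀ {A : Set} → List (A × A) → List A
flatten []             = []
flatten ((a , b) ∷ ps) = a ∷ b ∷ flatten ps

∨-trueˡ : ∀ {x} y → x ≡ true → x ∨ y ≡ true
∨-trueˡ _ refl = refl

∨-trueʳ : ∀ x {y} → y ≡ true → x ∨ y ≡ true
∨-trueʳ x refl = ∨-zeroʳ x

module PairChoices {A : Set} (p : ℕ) .{{_ : NonZero p}} (w : A → ℕ) where
  open Residues p

  DistinctPairs : List (A × A) → Set
  DistinctPairs = All λ { (a , b) → w a % p ≢ w b % p }

  module _ (c : ℕ) where

    record Choice (ps : List (A × A)) (v : ℕ) : Set where
      field
        chosen others : List A
        partition     : chosen ++ others ↭ flatten ps
        length-chosen : length chosen ≡ length ps
        sum-chosen    : (c + sum (map w chosen)) % p ≡ v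

    -- The residues c + (one weight from each pair), mod p.
    reachable : List (A × A) → ℕ → Bool
    reachable []             u = u ≡ᵇ c % p
    reachable ((a , b) ∷ ps) u = reachable ps (u ⊖ w a) ∨ reachable ps (u ⊖ w b)

    add-to-sum : ∀ x s v → v < p → (c + s) % p ≡ v ⊖ x → (c + (x + s)) % p ≡ v
    add-to-sum x s v v<p c+s≡v⊖x = begin
      (c + (x + s)) % p         ≡⟨ cong (_% p) (c+[x+s]≡c+s+x c x s) ⟩
      (c + s + x) % p           ≡⟨ +-cong {c + s} (sym (%-≈ (c + s))) refl ⟩
      (c + s) % p ⊕ x           ≡⟨ cong (_⊕ x) c+s≡v⊖x ⟩
      v ⊖ x ⊕ x                 ≡⟨ ⊖-⊕ v x v<p ⟩
      v                         ∎
      where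
      open ≡-Reasoning
      c+[x+s]≡c+s+x : ∀ c x s → c + (x + s) ≡ c + s + x
      c+[x+s]≡c+s+x = solve-∀

    choose-first : ∀ {ps v} a b → v < p → Choice ps (v ⊖ w a) → Choice ((a , b) ∷ ps) v
    choose-first a b v<p ch = record
      { chosen = a ∷ chosen ; others = b ∷ others
      ; partition = prep a (↭-trans (shift b chosen others) (prep b partition))
      ; length-chosen = cong suc length-chosen
      ; sum-chosen = add-to-sum (w a) _ _ v<p sum-chosen }
      where open Choice ch

    choose-second : ∀ {ps v} a b → v < p → Choice ps (v ⊖ w b) → Choice ((a , b) ∷ ps) v
    choose-second a b v<p ch = record
      { chosen = b ∷ chosen ; others = a ∷ others
      ; partition = ↭-trans (prep b (shift a chosen others)) (swap b a partition)
      ; length-chosen = cong suc length-chosen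
      ; sum-chosen = add-to-sum (w b) _ _ v<p sum-chosen }
      where open Choice ch

    reachable⇒choice : ∀ ps v → v < p → reachable ps v ≡ true → Choice ps v
    reachable⇒choice [] v v<p v≡c = record
      { chosen = [] ; others = [] ; partition = ↭-refl ; length-chosen = refl
      ; sum-chosen = trans (cong (_% p) (+-identityʳ c)) (sym (≡ᵇ⇒≡ v (c % p) (Equivalence.from T-≡ v≡c))) }
    reachable⇒choice ((a , b) ∷ ps) v v<p reach with reachable ps (v ⊖ w a) in reach-a
    ... | true  = choose-first a b v<p (reachable⇒choice ps (v ⊖ w a) (⊕-< v (neg (w a))) reach-a)
    ... | false = choose-second a b v<p (reachable⇒choice ps (v ⊖ w b) (⊕-< v (neg (w b))) reach)

    module _ (p-prime : Prime p) where

      -- With R = reachable ps, the new set is (R + a) ∪ (R + b), and R + a has the size of R.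
      -- If z ∈ R but z + (b − a) ∉ R, then z + b is in R + b but not in R + a.
      reachable-step : ∀ a b ps → w a % p ≢ w b % p →
                       1 ≤ count (reachable ps) p → count (reachable ps) p < p →
                       count (reachable ps) p < count (reachable ((a , b) ∷ ps)) p
      reachable-step a b ps a≢b nonempty proper
        with shift-escape p-prime (reachable ps) (w b + neg (w a)) (≢⇒⊖≢0 (w a) (w b) a≢b) nonempty proper
      ... | z , z<p , z∈R , z⊕d∉R = begin-strict
        count R p             ≡⟨ count-rotate p R (neg (w a)) ⟨
        count shifted p       <⟨ count-mono-< p (λ _ _ → ∨-trueˡ _) (z ⊕ w b) (⊕-< z (w b)) new∉shifted new∈R′ ⟩
        count R′ p            ∎
        where
        open ≤-Reasoning
        R R′ shifted : ℕ → Bool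
        R  = reachable ps
        R′ = reachable ((a , b) ∷ ps)
        shifted u = R (u ⊖ w a)
        new∉shifted : shifted (z ⊕ w b) ≡ false
        new∉shifted = trans (cong R (⊕-assoc z (w b) (neg (w a)))) z⊕d∉R
        new∈R′ : R′ (z ⊕ w b) ≡ true
        new∈R′ = ∨-trueʳ (shifted (z ⊕ w b)) (trans (cong R (⊕-⊖ z (w b) z<p)) z∈R)

      reachable-grows : ∀ ps → DistinctPairs ps → Full (reachable ps) ⊎ suc (length ps) ≤ count (reachable ps) p
      reachable-grows [] [] =
        inj₂ (count-member p (c % p) (m%n<n c p) (Equivalence.to T-≡ (≡⇒≡ᵇ (c % p) _ refl)))
      reachable-grows ((a , b) ∷ ps) (a≢b ∷ distinct) with reachable-grows ps distinct
      ... | inj₁ full  = inj₁ λ v v<p → ∨-trueˡ _ (full _ (⊕-< v _))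
      ... | inj₂ large with count (reachable ps) p <? p
      ...   | no ¬proper = inj₁ λ v v<p → ∨-trueˡ _ (count-full p (≮⇒≥ ¬proper) _ (⊕-< v _))
      ...   | yes proper =
        inj₂ (≤-trans (s≤s large) (reachable-step a b ps a≢b (≤-trans (s≤s z≤n) large) proper))

      choice-of-zero-sum : ∀ ps → pred p ≤ length ps → DistinctPairs ps → Choice ps 0
      choice-of-zero-sum ps p-1≤ distinct = reachable⇒choice ps 0 (>-nonZero⁻¹ p) reach0
        where
        reach0 : reachable ps 0 ≡ true
        reach0 with reachable-grows ps distinct
        ... | inj₁ full  = full 0 (>-nonZero⁻¹ p)
        ... | inj₂ large =
          count-full p (≤-trans (≤-reflexive (sym (suc-pred p))) (≤-trans (s≤s p-1≤) large)) 0 (>-nonZero⁻¹ p)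

-- Sub-multisets and the Erdős–Ginzburg–Ziv theorem

concatMap-↭ : ∀ {A B : Set} (f : A → List B) {xs ys} → xs ↭ ys → concatMap f xs ↭ concatMap f ys
concatMap-↭ f ↭.refl         = ↭-refl
concatMap-↭ f (↭.prep x p)   = ++⁺ˡ (f x) (concatMap-↭ f p)
concatMap-↭ f (↭.swap x y p) = ↭-trans (shifts (f x) (f y)) (++⁺ˡ (f y) (++⁺ˡ (f x) (concatMap-↭ f p)))
concatMap-↭ f (↭.trans p q)  = ↭-trans (concatMap-↭ f p) (concatMap-↭ f q)

infix 4 _⊑_

_⊑_ : ∀ {A : Set} → List A → List A → Set
ys ⊑ xs = ∃ λ zs → ys ++ zs ↭ xs

module _ {A : Set} where

  ↭⇒⊑ : {xs ys : List A} → xs ↭ ys → xs ⊑ ys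
  ↭⇒⊑ {xs} xs↭ys = [] , ↭-trans (↭-reflexive (++-identityʳ xs)) xs↭ys

  ⊑-trans : {xs ys zs : List A} → xs ⊑ ys → ys ⊑ zs → xs ⊑ zs
  ⊑-trans {xs} (us , xs+us↭ys) (vs , ys+vs↭zs) =
    us ++ vs , ↭-trans (↭-reflexive (sym (++-assoc xs us vs))) (↭-trans (++⁺ʳ vs xs+us↭ys) ys+vs↭zs)

  ⊑-++ : (xs ys : List A) → xs ⊑ xs ++ ys
  ⊑-++ xs ys = ys , ↭-refl

  ⊑-∷ : ∀ x (xs : List A) → xs ⊑ x ∷ xs
  ⊑-∷ x xs = [ x ] , ↭-sym (∷↭∷ʳ x xs)

  ∷⁺ : ∀ x {xs ys : List A} → xs ⊑ ys → x ∷ xs ⊑ x ∷ ys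
  ∷⁺ x (zs , xs+zs↭ys) = zs , prep x xs+zs↭ys

  ⊑-++⁺ˡ : ∀ (xs : List A) {ys zs} → ys ⊑ zs → xs ++ ys ⊑ xs ++ zs
  ⊑-++⁺ˡ xs {ys} (us , ys+us↭zs) = us , ↭-trans (↭-reflexive (++-assoc xs ys us)) (++⁺ˡ xs ys+us↭zs)

  ⊑-concatMap : ∀ {B : Set} (f : A → List B) {xs ys} → xs ⊑ ys → concatMap f xs ⊑ concatMap f ys
  ⊑-concatMap f {xs} (zs , xs+zs↭ys) =
    concatMap f zs , ↭-trans (↭-reflexive (sym (concatMap-++ f xs zs))) (concatMap-↭ f xs+zs↭ys)

  move-to-middle : ∀ (F M : List A) g G → F ++ M ++ g ∷ G ≡ F ++ (M ++ [ g ]) ++ G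
  move-to-middle F M g G = cong (F ++_) (sym (++-assoc M [ g ] G))

  split : ∀ k (xs : List A) → k ≤ length xs → ∃₂ λ F R → xs ≡ F ++ R × length F ≡ k
  split zero    xs       _        = [] , xs , refl , refl
  split (suc k) (x ∷ xs) (s≤s k≤) with split k xs k≤
  ... | F , R , refl , refl = x ∷ F , R , refl , refl

  split₃ : ∀ k (xs : List A) → k + k ≤ length xs →
           ∃₂ λ F G → ∃ λ R → xs ≡ F ++ G ++ R × length F ≡ k × length G ≡ k
  split₃ k xs 2k≤ with split k xs (≤-trans (m≤m+n k k) 2k≤)
  ... | F , rest , refl , refl with split k rest (+-cancelˡ-≤ k k _ (subst (k + k ≤_) (length-++ F) 2k≤))
  ... | G , R , refl , |G| = F , G , R , refl , refl , |G|

AllPairs-++⁻ˡ : ∀ {A : Set} {R : A → A → Set} xs {ys} → AllPairs R (xs ++ ys) → AllPairs R xs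
AllPairs-++⁻ˡ []       _            = []
AllPairs-++⁻ˡ (x ∷ xs) (Rx ∷ Rxs) = ++⁻ˡ xs Rx ∷ AllPairs-++⁻ˡ xs Rxs

module _ {A : Set} {xs ys : List A} (ys⊑xs : ys ⊑ xs) where

  ⊑-All : ∀ {P : A → Set} → All P xs → All P ys
  ⊑-All Pxs = let (zs , ys+zs↭xs) = ys⊑xs in ++⁻ˡ ys (All-resp-↭ (↭-sym ys+zs↭xs) Pxs)

  ⊑-Unique : Unique xs → Unique ys
  ⊑-Unique uxs = let (zs , ys+zs↭xs) = ys⊑xs in
    AllPairs-++⁻ˡ ys (↭ₛ.Unique-resp-↭ (setoid A) (↭⇒↭ₛ (↭-sym ys+zs↭xs)) uxs)

ZeroSumPart : ∀ {A : Set} → ℕ → (A → ℕ) → List A → Set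
ZeroSumPart m w xs = ∃ λ ys → ys ⊑ xs × length ys ≡ m × m ∣ sum (map w ys)

ErdősGinzburgZiv : ℕ → Set₁
ErdősGinzburgZiv m = ∀ {A : Set} (w : A → ℕ) (xs : List A) → m + m ≤ suc (length xs) → ZeroSumPart m w xs

module PrimeEGZ (p : ℕ) .{{_ : NonZero p}} (p-prime : Prime p) {A : Set} (w : A → ℕ) where
  open Residues p

  key : A → ℕ
  key x = w x % p

  _≤ₖ_ : A → A → Set
  _≤ₖ_ = _≤_ on key

  open PairChoices p w using (DistinctPairs)

  squeezed : ∀ a mid b rest → AllPairs _≤ₖ_ (a ∷ mid ++ b ∷ rest) → key a ≡ key b →
             All (λ x → key x ≡ key a) (a ∷ mid ++ [ b ])
  squeezed a []        b rest _ a≡b = refl ∷ sym a≡b ∷ []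
  squeezed a (x ∷ mid) b rest ((a≤x ∷ a≤) ∷ x≤ ∷ sorted) a≡b
    with squeezed a mid b rest (a≤ ∷ sorted) a≡b
  ... | _ ∷ others = refl ∷ ≤-antisym x≤a a≤x ∷ others
    where
    x≤a : key x ≤ key a
    x≤a = subst (key x ≤_) (sym a≡b) (All.head (++⁻ʳ mid x≤))

  -- Pairs the i-th elements of F and G.  Since F ++ M ++ G is sorted, a pair with equal
  -- residues encloses a run of |F| + |M| + 1 elements that share one residue.
  pair-up : ∀ F M G → length F ≡ length G → AllPairs _≤ₖ_ (F ++ M ++ G) →
    (∃ λ ps → flatten ps ↭ F ++ G × length ps ≡ length F × DistinctPairs ps)
    ⊎ (∃₂ λ B v → B ⊑ F ++ M ++ G × length B ≡ length F + length M + 1 × All (λ x → key x ≡ v) B)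
  pair-up []      M []      _ _ = inj₁ ([] , ↭-refl , refl , [])
  pair-up (f ∷ F) M (g ∷ G) |F|≡|G| sorted with key f ≟ key g
  ... | yes f≡g = inj₂ (f ∷ (F ++ M) ++ [ g ] , key f , block⊑ , block-length , squeezed f (F ++ M) g G sorted′ f≡g)
    where
    sorted′ : AllPairs _≤ₖ_ (f ∷ (F ++ M) ++ g ∷ G)
    sorted′ = subst (λ l → AllPairs _≤ₖ_ (f ∷ l)) (sym (++-assoc F M (g ∷ G))) sorted
    block⊑ : f ∷ (F ++ M) ++ [ g ] ⊑ f ∷ F ++ M ++ g ∷ G
    block⊑ = ∷⁺ f (subst (((F ++ M) ++ [ g ]) ⊑_) (trans (++-assoc (F ++ M) [ g ] G) (++-assoc F M (g ∷ G)))
                         (⊑-++ ((F ++ M) ++ [ g ]) G))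
    block-length : length (f ∷ (F ++ M) ++ [ g ]) ≡ length (f ∷ F) + length M + 1
    block-length = cong suc (trans (length-++ (F ++ M)) (cong (_+ 1) (length-++ F)))
  ... | no f≢g
    with pair-up F (M ++ [ g ]) G (suc-injective |F|≡|G|) (subst (AllPairs _≤ₖ_) (move-to-middle F M g G) (AllPairs.tail sorted))
  ...   | inj₁ (ps , flat , |ps| , distinct) =
    inj₁ ((f , g) ∷ ps , prep f (↭-trans (prep g flat) (↭-sym (shift g F G))) , cong suc |ps| , f≢g ∷ distinct)
  ...   | inj₂ (B , v , B⊑ , |B| , constant) =
    inj₂ (B , v , ⊑-trans B⊑ (subst (_⊑ f ∷ F ++ M ++ g ∷ G) (move-to-middle F M g G) (⊑-∷ f _)) , |B|′ , constant)
    where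
    shuffle : ∀ a b → a + (b + 1) + 1 ≡ suc a + b + 1
    shuffle = solve-∀
    |B|′ : length B ≡ length (f ∷ F) + length M + 1
    |B|′ = trans |B| (trans (cong (λ m → length F + m + 1) (length-++ M)) (shuffle (length F) (length M)))

  sum-constant : ∀ {v} B → All (λ x → key x ≡ v) B → sum (map w B) ≈ length B * v
  sum-constant []      []          = refl
  sum-constant (x ∷ B) (kx≡v ∷ kB) = +-cong (trans (sym (%-≈ (w x))) (cong (_% p) kx≡v)) (sum-constant B kB)

  constant-block : ∀ {v} B → All (λ x → key x ≡ v) B → length B ≡ p → p ∣ sum (map w B)
  constant-block {v} B constant |B|≡p = m%n≡0⇒n∣m _ p (begin
    sum (map w B) % p     ≡⟨ sum-constant B constant ⟩
    (length B * v) % p    ≡⟨ cong (λ m → (m * v) % p) |B|≡p ⟩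
    (p * v) % p           ≡⟨ cong (_% p) (*-comm p v) ⟩
    (v * p) % p           ≡⟨ m*n%n≡0 v p ⟩
    0                     ∎)
    where open ≡-Reasoning

  prefix⊑ : (F G R : List A) → F ++ G ⊑ F ++ G ++ R
  prefix⊑ F G R = subst (F ++ G ⊑_) (++-assoc F G R) (⊑-++ (F ++ G) R)

  egz-sorted : ∀ x₀ rest → AllPairs _≤ₖ_ rest → pred p + pred p ≤ length rest → ZeroSumPart p w (x₀ ∷ rest)
  egz-sorted x₀ rest sorted 2n≤ with split₃ (pred p) rest 2n≤
  ... | F , G , R , refl , |F| , |G|
    with pair-up F [] G (trans |F| (sym |G|))
                 (AllPairs-++⁻ˡ (F ++ G) (subst (AllPairs _≤ₖ_) (sym (++-assoc F G R)) sorted))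
  ... | inj₁ (ps , flat , |ps| , distinct) =
    x₀ ∷ chosen , ∷⁺ x₀ (⊑-trans (others , partition) (⊑-trans (↭⇒⊑ flat) (prefix⊑ F G R))) ,
    trans (cong suc (trans length-chosen (trans |ps| |F|))) (suc-pred p) ,
    m%n≡0⇒n∣m _ p sum-chosen
    where
    open PairChoices.Choice
      (PairChoices.choice-of-zero-sum p w (w x₀) p-prime ps (≤-reflexive (sym (trans |ps| |F|))) distinct)
  ... | inj₂ (B , v , B⊑ , |B| , constant) =
    B , ⊑-trans B⊑ (⊑-trans (prefix⊑ F G R) (⊑-∷ x₀ _)) , |B|≡p , constant-block B constant |B|≡p
    where
    |B|≡p : length B ≡ p
    |B|≡p = trans |B| (trans (cong (λ m → m + 0 + 1) |F|) (trans (cong (_+ 1) (+-identityʳ (pred p)))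
                          (trans (+-comm (pred p) 1) (suc-pred p))))

  open Sort (On.decTotalOrder ≤-decTotalOrder key) using (sort; sort-↭; sort-↗)

  egz : ∀ xs → p + p ≤ suc (length xs) → ZeroSumPart p w xs
  egz xs 2p≤1+|xs| with sort xs | sort-↭ xs | sort-↗ xs
  ... | [] | sorted↭xs | _ = ⊥-elim (<⇒≱ (+-mono-≤ (>-nonZero⁻¹ p) (>-nonZero⁻¹ p)) 2p≤1)
    where
    2p≤1 : p + p ≤ 1
    2p≤1 = subst (λ k → p + p ≤ suc k) (sym (↭-length sorted↭xs)) 2p≤1+|xs|
  ... | x₀ ∷ rest | sorted↭xs | sorted
    with egz-sorted x₀ rest (AllPairs.tail (Linked.Linked⇒AllPairs ≤-trans sorted)) 2n≤|rest|
    where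
    halve : ∀ n k → suc n + suc n ≤ suc (suc k) → n + n ≤ k
    halve n k (s≤s 2n+1≤k+1) = ≤-pred (subst (_≤ suc k) (+-suc n n) 2n+1≤k+1)
    2n≤|rest| : pred p + pred p ≤ length rest
    2n≤|rest| = halve (pred p) (length rest)
      (subst₂ (λ q k → q + q ≤ suc k) (sym (suc-pred p)) (sym (↭-length sorted↭xs)) 2p≤1+|xs|)
  ... | ys , ys⊑ , |ys| , p∣ = ys , ⊑-trans ys⊑ (↭⇒⊑ sorted↭xs) , |ys| , p∣

egz-prime : ∀ p → Prime p → ErdősGinzburgZiv p
egz-prime p p-prime w = PrimeEGZ.egz p ⦃ prime⇒nonZero p-prime ⦄ p-prime w

egz-1 : ErdősGinzburgZiv 1
egz-1 w []       (s≤s ())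
egz-1 w (x ∷ xs) _ = x ∷ [] , ⊑-++ (x ∷ []) xs , refl , 1∣ _

record Block {A : Set} (m : ℕ) (w : A → ℕ) : Set where
  field
    elements  : List A
    size      : length elements ≡ m
    divisible : m ∣ sum (map w elements)
  open _∣_ divisible public

module _ {p : ℕ} (egz-p : ErdősGinzburgZiv p) {A : Set} (w : A → ℕ) where

  extract-blocks : ∀ k xs → k * p + p ≤ suc (length xs) →
                   ∃ λ (bs : List (Block p w)) → length bs ≡ k × concatMap Block.elements bs ⊑ xs
  extract-blocks zero    xs _ = [] , refl , xs , ↭-refl
  extract-blocks (suc k) xs room with egz-p w xs room₁
    where
    room₁ : p + p ≤ suc (length xs)
    room₁ = ≤-trans (+-monoʳ-≤ p (m≤n+m p (k * p))) (≤-trans (≤-reflexive (sym (+-assoc p (k * p) p))) room)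
  ... | ys , (zs , ys+zs↭xs) , |ys| , p∣ with extract-blocks k zs room′
    where
    room′ : k * p + p ≤ suc (length zs)
    room′ = +-cancelˡ-≤ p _ _ (begin
      p + (k * p + p)           ≡⟨ +-assoc p (k * p) p ⟨
      suc k * p + p             ≤⟨ room ⟩
      suc (length xs)           ≡⟨ cong suc (↭-length ys+zs↭xs) ⟨
      suc (length (ys ++ zs))   ≡⟨ cong suc (trans (length-++ ys) (cong (_+ length zs) |ys|)) ⟩
      suc (p + length zs)       ≡⟨ +-suc p (length zs) ⟨
      p + suc (length zs)       ∎)
      where open ≤-Reasoning
  ... | bs , |bs| , bs⊑zs = record { elements = ys ; size = |ys| ; divisible = p∣ } ∷ bs , cong suc |bs| ,
                            ⊑-trans (⊑-++⁺ˡ ys bs⊑zs) (↭⇒⊑ ys+zs↭xs)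

  length-blocks : ∀ (bs : List (Block p w)) → length (concatMap Block.elements bs) ≡ length bs * p
  length-blocks []       = refl
  length-blocks (b ∷ bs) = trans (length-++ (Block.elements b)) (cong₂ _+_ (Block.size b) (length-blocks bs))

  sum-blocks : ∀ (bs : List (Block p w)) → sum (map w (concatMap Block.elements bs)) ≡ sum (map Block.quotient bs) * p
  sum-blocks []       = refl
  sum-blocks (b ∷ bs) = begin
    sum (map w (ys ++ rest))               ≡⟨ cong sum (map-++ w ys rest) ⟩
    sum (map w ys ++ map w rest)           ≡⟨ sum-++ (map w ys) _ ⟩
    sum (map w ys) + sum (map w rest)      ≡⟨ cong₂ _+_ (Block.equality b) (sum-blocks bs) ⟩
    Block.quotient b * p + sum (map Block.quotient bs) * p ≡⟨ *-distribʳ-+ p (Block.quotient b) _ ⟨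
    sum (map Block.quotient (b ∷ bs)) * p  ∎
    where
    open ≡-Reasoning
    ys rest : List A
    ys   = Block.elements b
    rest = concatMap Block.elements bs

-- Take 2q − 1 disjoint blocks of p elements, each with sum divisible by p, and then q of the
-- blocks whose quotients add up to a multiple of q.
egz-* : ∀ {p q} .{{_ : NonZero q}} → ErdősGinzburgZiv p → ErdősGinzburgZiv q → ErdősGinzburgZiv (p * q)
egz-* {p} {suc q} egz-p egz-q {A} w xs room = combine (extract-blocks egz-p w (suc q + q) xs room′)
  where
  2pq≡[2q+1]p+p : ∀ p q → p * suc q + p * suc q ≡ (suc q + q) * p + p
  2pq≡[2q+1]p+p = solve-∀
  room′ : (suc q + q) * p + p ≤ suc (length xs)
  room′ = subst (_≤ suc (length xs)) (2pq≡[2q+1]p+p p q) room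
  combine : (∃ λ (bs : List (Block p w)) → length bs ≡ suc q + q × concatMap Block.elements bs ⊑ xs) →
            ZeroSumPart (p * suc q) w xs
  combine (bs , |bs| , bs⊑xs) with egz-q Block.quotient bs (≤-reflexive (cong suc (trans (+-suc q q) (sym |bs|))))
  ... | cs , cs⊑bs , |cs| , q∣Σ =
    concatMap Block.elements cs ,
    ⊑-trans (⊑-concatMap Block.elements cs⊑bs) bs⊑xs ,
    trans (length-blocks egz-p w cs) (trans (cong (_* p) |cs|) (*-comm (suc q) p)) ,
    subst₂ _∣_ (*-comm (suc q) p) (sym (sum-blocks egz-p w cs)) (*-monoˡ-∣ p q∣Σ)

egz-product : ∀ {ps} → All Prime ps → ErdősGinzburgZiv (product ps)
egz-product []             = egz-1
egz-product (p-prime ∷ ps-prime) =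
  egz-* ⦃ productOfPrimes≢0 ps-prime ⦄ (egz-prime _ p-prime) (egz-product ps-prime)

egz : ∀ n .{{_ : NonZero n}} → ErdősGinzburgZiv n
egz n = subst ErdősGinzburgZiv (sym isFactorisation) (egz-product factorsPrime)
  where open PrimeFactorisation (factorise n)

-- Zero-sum sets of indices

strictly-increasing : ∀ {xs} → Linked _≤_ xs → Unique xs → Linked _<_ xs
strictly-increasing []        _                   = []
strictly-increasing [-]       _                   = [-]
strictly-increasing (x≤y ∷ l) ((x≢y ∷ _) ∷ uxs) = ≤∧≢⇒< x≤y x≢y ∷ strictly-increasing l uxs

module _ (m : ℕ) .{{_ : NonZero m}} (a : ℕ → ℤ) where

  residue : ℕ → ℕ
  residue i = a i %ℕ m

  sumΔ-by-residues : ∀ I → sumΔ a I ≡ ℤ.+ sum (map residue I) +ℤ sumΔ (λ i → a i /ℕ m) I *ℤ ℤ.+ m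
  sumΔ-by-residues []      = refl
  sumΔ-by-residues (i ∷ I) = begin
    a i +ℤ sumΔ a I
      ≡⟨ cong₂ _+ℤ_ (a≡a%ℕn+[a/ℕn]*n (a i) m) (sumΔ-by-residues I) ⟩
    (ℤ.+ residue i +ℤ (a i /ℕ m) *ℤ ℤ.+ m) +ℤ (ℤ.+ R +ℤ Q *ℤ ℤ.+ m)
      ≡⟨ regroup (ℤ.+ residue i) (a i /ℕ m) (ℤ.+ R) Q (ℤ.+ m) ⟩
    (ℤ.+ residue i +ℤ ℤ.+ R) +ℤ ((a i /ℕ m) +ℤ Q) *ℤ ℤ.+ m
      ≡⟨ cong (_+ℤ ((a i /ℕ m) +ℤ Q) *ℤ ℤ.+ m) (pos-+ (residue i) R) ⟨
    ℤ.+ (residue i + R) +ℤ ((a i /ℕ m) +ℤ Q) *ℤ ℤ.+ m ∎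
    where
    open ≡-Reasoning
    R : ℕ
    R = sum (map residue I)
    Q : ℤ
    Q = sumΔ (λ i → a i /ℕ m) I
    regroup : ∀ r q s t n → (r +ℤ q *ℤ n) +ℤ (s +ℤ t *ℤ n) ≡ (r +ℤ s) +ℤ (q +ℤ t) *ℤ n
    regroup = ℤ-Solver.solve-∀

  zeroSum-by-residues : ∀ I → m ∣ sum (map residue I) → ZeroSumMod a m I
  zeroSum-by-residues I m∣R = Signed.∣⇒∣ᵤ (subst (Signed._∣_ (ℤ.+ m)) (sym (sumΔ-by-residues I))
    (Signed.∣m∣n⇒∣m+n (Signed.∣ᵤ⇒∣ {i = ℤ.+ sum (map residue I)} m∣R)
                      (Signed.∣n⇒∣m*n (sumΔ (λ i → a i /ℕ m) I) Signed.∣-refl)))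

  open Sort ≤-decTotalOrder using (sort; sort-↭; sort-↗)

  egz-indices : ∃ λ I → Linked _<_ I × All (_< m + m ∸ 1) I × length I ≡ m × ZeroSumMod a m I
  egz-indices with egz m residue (upTo (m + m ∸ 1)) room
    where
    room : m + m ≤ suc (length (upTo (m + m ∸ 1)))
    room = subst (m + m ≤_) (cong suc (sym (length-upTo _))) (m≤n+m∸n (m + m) 1)
  ... | ys , ys⊑ , |ys| , m∣R =
    sort ys ,
    strictly-increasing (sort-↗ ys) (⊑-Unique sort⊑ (upTo⁺ _)) ,
    ⊑-All sort⊑ (all-upTo _) ,
    trans (↭-length (sort-↭ ys)) |ys| ,
    zeroSum-by-residues (sort ys) (subst (m ∣_) (sym (sum-↭ (map⁺ residue (sort-↭ ys)))) m∣R)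
    where
    sort⊑ : sort ys ⊑ upTo (m + m ∸ 1)
    sort⊑ = ⊑-trans (↭⇒⊑ (sort-↭ ys)) ys⊑

-- Increasing lists and their counts in intervals

maxL-map : ∀ (f : ℕ → ℕ) x xs → maxL (map f (x ∷ xs)) ≡ f (maxL (x ∷ xs))
maxL-map f x []       = refl
maxL-map f x (y ∷ ys) = maxL-map f y ys

maxL∈ : ∀ x xs → maxL (x ∷ xs) ∈ x ∷ xs
maxL∈ x []       = here refl
maxL∈ x (y ∷ ys) = there (maxL∈ y ys)

All-maxL : ∀ {P : ℕ → Set} x xs → All P (x ∷ xs) → P (maxL (x ∷ xs))
All-maxL x []       (Px ∷ _)   = Px
All-maxL x (y ∷ ys) (_  ∷ Pys) = All-maxL y ys Pys

head+length≤maxL : ∀ x xs → Linked _<_ (x ∷ xs) → x + length xs ≤ maxL (x ∷ xs)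
head+length≤maxL x []       _           = ≤-reflexive (+-identityʳ x)
head+length≤maxL x (y ∷ ys) (x<y ∷ ys↑) = begin
  x + suc (length ys)   ≡⟨ +-suc x (length ys) ⟩
  suc x + length ys     ≤⟨ +-monoˡ-≤ (length ys) x<y ⟩
  y + length ys         ≤⟨ head+length≤maxL y ys ys↑ ⟩
  maxL (y ∷ ys)         ∎
  where open ≤-Reasoning

head≤maxL : ∀ x xs → Linked _<_ (x ∷ xs) → x ≤ maxL (x ∷ xs)
head≤maxL x xs xs↑ = m+n≤o⇒m≤o x (head+length≤maxL x xs xs↑)

sumΔ-map : ∀ (Δ : ℕ → ℤ) (f : ℕ → ℕ) xs → sumΔ Δ (map f xs) ≡ sumΔ (Δ ∘ f) xs
sumΔ-map Δ f []       = refl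
sumΔ-map Δ f (x ∷ xs) = cong (Δ (f x) +ℤ_) (sumΔ-map Δ f xs)

ZeroSumMod-map : ∀ (Δ : ℕ → ℤ) {m} (f : ℕ → ℕ) xs → ZeroSumMod (Δ ∘ f) m xs → ZeroSumMod Δ m (map f xs)
ZeroSumMod-map Δ {m} f xs = subst (ℤ.+ m ℤ∣.∣_) (sym (sumΔ-map Δ f xs))

InRange : ℕ → ℕ → ℕ → Set
InRange a b x = a ≤ x × x < b

indicator : ℕ → ℕ → ℕ → ℕ
indicator a b x with a ≤? x | x <? b
... | yes _ | yes _ = 1
... | _     | _     = 0

countIn : ℕ → ℕ → List ℕ → ℕ
countIn a b []       = 0
countIn a b (x ∷ xs) = indicator a b x + countIn a b xs

module _ {a b : ℕ} where

  indicator-in : ∀ {x} → InRange a b x → indicator a b x ≡ 1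
  indicator-in {x} (a≤x , x<b) with a ≤? x | x <? b
  ... | yes _   | yes _   = refl
  ... | no a≰x  | _       = contradiction a≤x a≰x
  ... | yes _   | no x≮b  = contradiction x<b x≮b

  indicator-out : ∀ {x} → ¬ InRange a b x → indicator a b x ≡ 0
  indicator-out {x} x∉ with a ≤? x | x <? b
  ... | yes a≤x | yes x<b = contradiction (a≤x , x<b) x∉
  ... | no _    | _       = refl
  ... | yes _   | no _    = refl

  indicator≤1 : ∀ x → indicator a b x ≤ 1
  indicator≤1 x with a ≤? x | x <? b
  ... | yes _ | yes _ = ≤-refl
  ... | no _  | _     = z≤n
  ... | yes _ | no _  = z≤n

  countIn≤length : ∀ xs → countIn a b xs ≤ length xs
  countIn≤length []       = z≤n
  countIn≤length (x ∷ xs) = +-mono-≤ (indicator≤1 x) (countIn≤length xs)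

  countIn-all : ∀ xs → All (InRange a b) xs → countIn a b xs ≡ length xs
  countIn-all []       []           = refl
  countIn-all (x ∷ xs) (x∈ ∷ xs∈) = cong₂ _+_ (indicator-in x∈) (countIn-all xs xs∈)

  countIn-∈ : ∀ {x xs} → x ∈ xs → InRange a b x → 1 ≤ countIn a b xs
  countIn-∈ {xs = y ∷ ys} (here refl) x∈ = ≤-trans (≤-reflexive (sym (indicator-in x∈))) (m≤m+n _ _)
  countIn-∈ {xs = y ∷ ys} (there x∈ys) x∈ = ≤-trans (countIn-∈ x∈ys x∈) (m≤n+m _ _)

  indicator-below : ∀ {x} → x < a → indicator a b x ≡ 0
  indicator-below x<a = indicator-out λ (a≤x , _) → <⇒≱ x<a a≤x

  indicator-above : ∀ {x} → b ≤ x → indicator a b x ≡ 0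
  indicator-above b≤x = indicator-out λ (_ , x<b) → <⇒≱ x<b b≤x

  countIn-head : ∀ x xs → Linked _<_ (x ∷ xs) → 1 ≤ countIn a b (x ∷ xs) → x + countIn a b (x ∷ xs) ≤ b
  countIn-head x xs xs↑ counted with a ≤? x | x <? b
  countIn-head x []       _           _       | yes _ | yes x<b = ≤-trans (≤-reflexive (+-comm x 1)) x<b
  countIn-head x (y ∷ ys) (x<y ∷ ys↑) _       | yes _ | yes x<b with countIn a b (y ∷ ys) in c≡
  ... | zero  = ≤-trans (≤-reflexive (+-comm x 1)) x<b
  ... | suc c = begin
    x + suc (suc c)           ≡⟨ +-suc x (suc c) ⟩
    suc x + suc c             ≤⟨ +-monoˡ-≤ (suc c) x<y ⟩
    y + suc c                 ≡⟨ cong (y +_) c≡ ⟨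
    y + countIn a b (y ∷ ys)  ≤⟨ countIn-head y ys ys↑ (≤-trans (s≤s z≤n) (≤-reflexive (sym c≡))) ⟩
    b                         ∎
    where open ≤-Reasoning
  countIn-head x []       _           ()      | yes _ | no _
  countIn-head x (y ∷ ys) (x<y ∷ ys↑) counted | yes _ | no _ =
    ≤-trans (+-monoˡ-≤ _ (<⇒≤ x<y)) (countIn-head y ys ys↑ counted)
  countIn-head x []       _           ()      | no _  | _
  countIn-head x (y ∷ ys) (x<y ∷ ys↑) counted | no _  | _ =
    ≤-trans (+-monoˡ-≤ _ (<⇒≤ x<y)) (countIn-head y ys ys↑ counted)

  countIn-skip : ∀ {x} xs → x < a → countIn a b (x ∷ xs) ≡ countIn a b xs
  countIn-skip xs x<a = cong (_+ countIn a b xs) (indicator-below x<a)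

  countIn-bound : a ≤ b → ∀ xs → Linked _<_ xs → a + countIn a b xs ≤ b
  countIn-bound a≤b []       _   = ≤-trans (≤-reflexive (+-identityʳ a)) a≤b
  countIn-bound a≤b (x ∷ xs) xs↑ with x <? a | 1 ≤? countIn a b (x ∷ xs)
  ... | yes x<a | _         =
    subst (λ k → a + k ≤ b) (sym (countIn-skip xs x<a)) (countIn-bound a≤b xs (Linked.tail xs↑))
  ... | no x≮a  | yes pos   = ≤-trans (+-monoˡ-≤ _ (≮⇒≥ x≮a)) (countIn-head x xs xs↑ pos)
  ... | no _    | no ¬pos   =
    ≤-trans (≤-reflexive (trans (cong (a +_) (n<1⇒n≡0 (≰⇒> ¬pos))) (+-identityʳ a))) a≤b

  countIn-max : ∀ x xs → Linked _<_ (x ∷ xs) → 1 ≤ countIn a b (x ∷ xs) →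
                a + countIn a b (x ∷ xs) ≤ suc (maxL (x ∷ xs))
  countIn-max x xs xs↑ counted with x <? a
  countIn-max x []       _           counted | yes x<a = contradiction (subst (1 ≤_) (countIn-skip [] x<a) counted) λ ()
  countIn-max x (y ∷ ys) (_ ∷ ys↑)   counted | yes x<a =
    subst (λ k → a + k ≤ suc (maxL (y ∷ ys))) (sym (countIn-skip (y ∷ ys) x<a))
          (countIn-max y ys ys↑ (subst (1 ≤_) (countIn-skip (y ∷ ys) x<a) counted))
  countIn-max x xs       xs↑         _       | no x≮a  = begin
    a + countIn a b (x ∷ xs)  ≤⟨ +-mono-≤ (≮⇒≥ x≮a) (countIn≤length (x ∷ xs)) ⟩
    x + suc (length xs)       ≡⟨ +-suc x (length xs) ⟩
    suc (x + length xs)       ≤⟨ s≤s (head+length≤maxL x xs xs↑) ⟩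
    suc (maxL (x ∷ xs))       ∎
    where open ≤-Reasoning

indicator-split : ∀ {a b c} → a ≤ b → b ≤ c → ∀ x → indicator a b x + indicator b c x ≡ indicator a c x
indicator-split {a} {b} {c} a≤b b≤c x with <-≤-connex x a | <-≤-connex x b | <-≤-connex x c
... | inj₁ x<a | _        | _        =
  trans (cong₂ _+_ (indicator-below {a} {b} x<a) (indicator-below {b} {c} (<-≤-trans x<a a≤b)))
        (sym (indicator-below {a} {c} x<a))
... | inj₂ a≤x | inj₁ x<b | _        =
  trans (cong₂ _+_ (indicator-in {a} {b} (a≤x , x<b)) (indicator-below {b} {c} x<b))
        (sym (indicator-in {a} {c} (a≤x , <-≤-trans x<b b≤c)))
... | inj₂ a≤x | inj₂ b≤x | inj₁ x<c =
  trans (cong₂ _+_ (indicator-above {a} {b} b≤x) (indicator-in {b} {c} (b≤x , x<c)))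
        (sym (indicator-in {a} {c} (a≤x , x<c)))
... | inj₂ _   | inj₂ b≤x | inj₂ c≤x =
  trans (cong₂ _+_ (indicator-above {a} {b} b≤x) (indicator-above {b} {c} c≤x))
        (sym (indicator-above {a} {c} c≤x))

countIn-split : ∀ {a b c} → a ≤ b → b ≤ c → ∀ xs → countIn a b xs + countIn b c xs ≡ countIn a c xs
countIn-split a≤b b≤c []       = refl
countIn-split {a} {b} {c} a≤b b≤c (x ∷ xs) =
  trans (interchange (indicator a b x) (countIn a b xs) (indicator b c x) (countIn b c xs))
        (cong₂ _+_ (indicator-split a≤b b≤c x) (countIn-split a≤b b≤c xs))
  where
  interchange : ∀ m n o p → m + n + (o + p) ≡ m + o + (n + p)
  interchange = solve-∀

straddle : ∀ {a b g d} x xs → Linked _<_ (x ∷ xs) →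
           1 ≤ countIn a b (x ∷ xs) → 1 ≤ countIn (b + g) d (x ∷ xs) →
           x + countIn a b (x ∷ xs) + g + countIn (b + g) d (x ∷ xs) ≤ suc (maxL (x ∷ xs))
straddle {a} {b} {g} {d} x xs xs↑ low high = +-cancelˡ-≤ b _ _ (begin
  b + (x + k₁ + g + k₂)       ≡⟨ regroup b x k₁ g k₂ ⟩
  (x + k₁) + (b + g + k₂)     ≤⟨ +-mono-≤ (countIn-head x xs xs↑ low) (countIn-max x xs xs↑ high) ⟩
  b + suc (maxL (x ∷ xs))     ∎)
  where
  open ≤-Reasoning
  k₁ k₂ : ℕ
  k₁ = countIn a b (x ∷ xs)
  k₂ = countIn (b + g) d (x ∷ xs)
  regroup : ∀ b x k₁ g k₂ → b + (x + k₁ + g + k₂) ≡ (x + k₁) + (b + g + k₂)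
  regroup = solve-∀

diam-transfer : ∀ {x xs y ys g} → y ≤ maxL (y ∷ ys) → diam (x ∷ xs) ≤ diam (y ∷ ys) →
                x + g ≤ maxL (x ∷ xs) → y + g ≤ maxL (y ∷ ys)
diam-transfer {x} {xs} {y} {ys} {g} y≤M₂ diam≤ x+g≤M₁ = subst (_≤ maxL (y ∷ ys)) (+-comm g y)
  (m≤o∸n⇒m+n≤o g y≤M₂ (≤-trans (m+n≤o⇒m≤o∸n g (subst (_≤ maxL (x ∷ xs)) (+-comm x g) x+g≤M₁))
                                diam≤))

-- Here s = t + 1 and r = r′ + 1, and c = 2s − 1 − r is the length of each jump of φ.
module UpperBound (t r′ c : ℕ) (r′+c≡t+t : r′ + c ≡ t + t) (1≤r′ : 1 ≤ r′) where

  s r K N : ℕ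
  s = suc t
  r = suc r′
  K = r′ + c
  N = s + s + K + K

  step : ℕ → ℕ → ℕ
  step k j with k ≤? j
  ... | yes _ = c
  ... | no  _ = 0

  step-on : ∀ {k j} → k ≤ j → step k j ≡ c
  step-on {k} {j} k≤j with k ≤? j
  ... | yes _   = refl
  ... | no  k≰j = contradiction k≤j k≰j

  step-off : ∀ {k j} → j < k → step k j ≡ 0
  step-off {k} {j} j<k with k ≤? j
  ... | yes k≤j = contradiction k≤j (<⇒≱ j<k)
  ... | no  _   = refl

  step≤c : ∀ k j → step k j ≤ c
  step≤c k j with k ≤? j
  ... | yes _ = ≤-refl
  ... | no  _ = z≤n

  step-mono : ∀ k {i j} → i ≤ j → step k i ≤ step k j
  step-mono k {i} {j} i≤j with k ≤? i | k ≤? j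
  ... | yes _   | yes _   = ≤-refl
  ... | yes k≤i | no  k≰j = contradiction (≤-trans k≤i i≤j) k≰j
  ... | no  _   | _       = z≤n

  φ : ℕ → ℕ
  φ j = s + s + j + step 1 j + step r j

  φ-mono-≤ : ∀ {i j} → i ≤ j → φ i ≤ φ j
  φ-mono-≤ i≤j = +-mono-≤ (+-mono-≤ (+-monoʳ-≤ (s + s) i≤j) (step-mono 1 i≤j)) (step-mono r i≤j)

  φ-mono-< : ∀ {i j} → i < j → φ i < φ j
  φ-mono-< {i} i<j =
    +-mono-≤ (+-mono-≤ (≤-trans (≤-reflexive (sym (+-suc (s + s) i))) (+-monoʳ-≤ (s + s) i<j)) (step-mono 1 (<⇒≤ i<j)))
             (step-mono r (<⇒≤ i<j))

  2s≤φ : ∀ j → s + s ≤ φ j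
  2s≤φ j = ≤-trans (m≤m+n (s + s) j) (≤-trans (m≤m+n _ (step 1 j)) (m≤m+n _ (step r j)))

  φ≤N : ∀ j → j ≤ r′ + r′ → φ j ≤ N
  φ≤N j j≤2r′ = begin
    φ j                             ≤⟨ +-mono-≤ (+-mono-≤ (+-monoʳ-≤ (s + s) j≤2r′) (step≤c 1 j)) (step≤c r j) ⟩
    s + s + (r′ + r′) + c + c       ≡⟨ regroup (s + s) r′ c ⟩
    N                               ∎
    where
    open ≤-Reasoning
    regroup : ∀ a r c → a + (r + r) + c + c ≡ a + (r + c) + (r + c)
    regroup = solve-∀

  φ-spread : ∀ j → j ≤ r′ → φ j + K ≤ φ (j + r′)
  φ-spread zero _ = ≤-reflexive (begin
    φ 0 + K                          ≡⟨ cong₂ (λ u v → s + s + 0 + u + v + K) (step-off {1} 0<1) (step-off {r} 0<r) ⟩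
    s + s + 0 + 0 + 0 + (r′ + c)     ≡⟨ regroup (s + s) r′ c ⟩
    s + s + r′ + c + 0               ≡⟨ cong₂ (λ u v → s + s + r′ + u + v) (step-on 1≤r′) (step-off {r} {r′} ≤-refl) ⟨
    φ r′                             ∎)
    where
    open ≡-Reasoning
    0<1 : 0 < 1
    0<1 = s≤s z≤n
    0<r : 0 < r
    0<r = s≤s z≤n
    regroup : ∀ a r c → a + 0 + 0 + 0 + (r + c) ≡ a + r + c + 0
    regroup = solve-∀
  φ-spread (suc j) 1+j≤r′ = ≤-reflexive (begin
    φ (suc j) + K                    ≡⟨ cong₂ (λ u v → s + s + suc j + u + v + K) (step-on 1≤1+j) (step-off {r} (s≤s 1+j≤r′)) ⟩
    s + s + suc j + c + 0 + (r′ + c) ≡⟨ regroup (s + s) j r′ c ⟩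
    s + s + (suc j + r′) + c + c     ≡⟨ cong₂ (λ u v → s + s + (suc j + r′) + u + v) (step-on 1≤1+j+r′) (step-on r≤1+j+r′) ⟨
    φ (suc j + r′)                   ∎)
    where
    open ≡-Reasoning
    1≤1+j : 1 ≤ suc j
    1≤1+j = s≤s z≤n
    1≤1+j+r′ : 1 ≤ suc j + r′
    1≤1+j+r′ = s≤s z≤n
    r≤1+j+r′ : r ≤ suc j + r′
    r≤1+j+r′ = s≤s (m≤n+m r′ j)
    regroup : ∀ a j r c → a + suc j + c + 0 + (r + c) ≡ a + (suc j + r) + c + c
    regroup = solve-∀

  K≤diam-φ : ∀ j J → Linked _<_ (j ∷ J) → length J ≡ r′ → All (_< r′ + r) (j ∷ J) → K ≤ diam (map φ (j ∷ J))
  K≤diam-φ j J J↑ |J| J< = m+n≤o⇒m≤o∸n K (begin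
    K + φ j                ≡⟨ +-comm K (φ j) ⟩
    φ j + K                ≤⟨ φ-spread j j≤r′ ⟩
    φ (j + r′)             ≤⟨ φ-mono-≤ j+r′≤M ⟩
    φ M                    ≡⟨ maxL-map φ j J ⟨
    maxL (map φ (j ∷ J))   ∎)
    where
    open ≤-Reasoning
    M : ℕ
    M = maxL (j ∷ J)
    j+r′≤M : j + r′ ≤ M
    j+r′≤M = subst (λ l → j + l ≤ M) |J| (head+length≤maxL j J J↑)
    M≤2r′ : M ≤ r′ + r′
    M≤2r′ = ≤-pred (subst (M <_) (+-suc r′ r′) (All-maxL j J J<))
    j≤r′ : j ≤ r′
    j≤r′ = +-cancelʳ-≤ r′ j r′ (≤-trans j+r′≤M M≤2r′)

  diam-suc≤K : ∀ i I → All (_< t + s) (i ∷ I) → diam (map suc (i ∷ I)) ≤ K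
  diam-suc≤K i I I< = begin
    maxL (map suc (i ∷ I)) ∸ suc i   ≡⟨ cong (_∸ suc i) (maxL-map suc i I) ⟩
    M ∸ i                            ≤⟨ m∸n≤m M i ⟩
    M                                ≤⟨ ≤-pred (subst (M <_) (+-suc t t) (All-maxL i I I<)) ⟩
    t + t                            ≡⟨ r′+c≡t+t ⟨
    K                                ∎
    where
    open ≤-Reasoning
    M : ℕ
    M = maxL (i ∷ I)

  t+s≤N : t + s ≤ N
  t+s≤N = ≤-trans (+-monoˡ-≤ s (n≤1+n t)) (≤-trans (m≤m+n (s + s) K) (m≤m+n (s + s + K) K))

  suc-range : ∀ {I} → All (_< t + s) I → All (λ x → 1 ≤ x × x ≤ N) (map suc I)
  suc-range I< = Allₚ.map⁺ (All.map (λ i< → s≤s z≤n , ≤-trans i< t+s≤N) I<)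

  φ-range : ∀ {J} → All (_< r′ + r) J → All (λ x → 1 ≤ x × x ≤ N) (map φ J)
  φ-range J< = Allₚ.map⁺ (All.map (λ {j} j< → ≤-trans (s≤s z≤n) (2s≤φ j) , φ≤N j (≤-pred (subst (j <_) (+-suc r′ r′) j<)))
                                  J<)

  suc<φ : ∀ i I j → All (_< t + s) (i ∷ I) → maxL (map suc (i ∷ I)) < φ j
  suc<φ i I j I< = begin-strict
    maxL (map suc (i ∷ I))   ≡⟨ maxL-map suc i I ⟩
    suc (maxL (i ∷ I))       ≤⟨ All-maxL i I I< ⟩
    t + s                    <⟨ ≤-refl ⟩
    s + s                    ≤⟨ 2s≤φ j ⟩
    φ j                      ∎
    where open ≤-Reasoning

  upper : Good s r N
  upper Δ with egz-indices s (Δ ∘ suc) | egz-indices r (Δ ∘ φ)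
  ... | [] , _ , _ , () , _ | _
  ... | _ | [] , _ , _ , () , _
  ... | i ∷ I , I↑ , I< , |I| , zs₁ | j ∷ J , J↑ , J< , |J| , zs₂ =
    map suc (i ∷ I) , map φ (j ∷ J) ,
    (Linked.map⁺ (Linked.map s≤s I↑) , suc-range I<) ,
    (Linked.map⁺ (Linked.map φ-mono-< J↑) , φ-range J<) ,
    ZeroSumMod-map Δ suc (i ∷ I) zs₁ , ZeroSumMod-map Δ φ (j ∷ J) zs₂ ,
    trans (length-map suc (i ∷ I)) |I| , trans (length-map φ (j ∷ J)) |J| ,
    suc<φ i I j I< ,
    ≤-trans (diam-suc≤K i I I<) (K≤diam-φ j J J↑ (suc-injective |J|) J<)

divisor-of-small : ∀ {m n} → m ∣ n → n ≤ m → n ≡ 0 ⊎ n ≡ m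
divisor-of-small     (divides zero    n≡0)     _   = inj₁ n≡0
divisor-of-small {m} (divides (suc q) n≡m+q*m) n≤m =
  inj₂ (≤-antisym n≤m (≤-trans (m≤m+n m (q * m)) (≤-reflexive (sym n≡m+q*m))))

coprime-summand : ∀ {m n a b} → Coprime m n → m ∣ n * a + m * b → m ∣ a
coprime-summand {m} {n} {a} {b} m⊥n m∣ =
  coprime-divisor m⊥n (∣m+n∣m⇒∣n (subst (m ∣_) (+-comm (n * a) (m * b)) m∣) (m∣m*n b))

both-positive : ∀ {t k₁ k₂} → k₁ ≤ t → k₂ ≤ t → k₁ + k₂ ≡ suc t → 1 ≤ k₁ × 1 ≤ k₂
both-positive {t} {zero}            _    k₂≤t k₂≡1+t = ⊥-elim (n≮n t (subst (_≤ t) k₂≡1+t k₂≤t))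
both-positive {t} {suc k₁} {zero}   k₁≤t _    k₁≡t   =
  ⊥-elim (n≮n t (subst (_≤ t) (trans (sym (+-identityʳ (suc k₁))) k₁≡t) k₁≤t))
both-positive     {k₁ = suc _} {suc _} _ _ _         = s≤s z≤n , s≤s z≤n

-- Here s = t + 1, r = r′ + 1 and N = 6s − 5.
module LowerBound (t r′ : ℕ) (t≤r′ : t ≤ r′) (r⊥s : Coprime (suc r′) (suc t)) where

  s r b₁ b₂ b₃ b₄ b₅ N : ℕ
  s  = suc t
  r  = suc r′
  b₁ = suc t
  b₂ = b₁ + t
  b₃ = b₂ + t
  b₄ = b₃ + t
  b₅ = suc b₄
  N  = b₄ + (t + t)

  colour : ℕ → ℕ
  colour x = r * (indicator b₁ b₂ x + indicator b₃ b₄ x) + s * indicator b₅ (suc N) x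

  Δ : ℕ → ℤ
  Δ x = ℤ.+ colour x

  #r #s : List ℕ → ℕ
  #r S = countIn b₁ b₂ S + countIn b₃ b₄ S
  #s S = countIn b₅ (suc N) S

  sumΔ-colour : ∀ S → sumΔ Δ S ≡ ℤ.+ (r * #r S + s * #s S)
  sumΔ-colour []      = cong ℤ.+_ (sym (trans (cong (_+ s * 0) (*-zeroʳ r)) (*-zeroʳ s)))
  sumΔ-colour (x ∷ S) = begin
    Δ x +ℤ sumΔ Δ S                                  ≡⟨ cong (Δ x +ℤ_) (sumΔ-colour S) ⟩
    Δ x +ℤ ℤ.+ (r * #r S + s * #s S)                 ≡⟨ pos-+ (colour x) _ ⟨
    ℤ.+ (colour x + (r * #r S + s * #s S))
      ≡⟨ cong ℤ.+_ (regroup r s (indicator b₁ b₂ x) (indicator b₃ b₄ x) (indicator b₅ (suc N) x)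
                            (countIn b₁ b₂ S) (countIn b₃ b₄ S) (#s S)) ⟩
    ℤ.+ (r * #r (x ∷ S) + s * #s (x ∷ S))            ∎
    where
    open ≡-Reasoning
    regroup : ∀ r s i j k a b c → r * (i + j) + s * k + (r * (a + b) + s * c) ≡ r * (i + a + (j + b)) + s * (k + c)
    regroup = solve-∀

  1≤b₁ : 1 ≤ b₁
  1≤b₁ = s≤s z≤n

  b₁≤b₂ : b₁ ≤ b₂
  b₁≤b₂ = m≤m+n b₁ t

  b₂≤b₃ : b₂ ≤ b₃
  b₂≤b₃ = m≤m+n b₂ t

  b₃≤b₄ : b₃ ≤ b₄
  b₃≤b₄ = m≤m+n b₃ t

  b₄≤1+N : b₄ ≤ suc N
  b₄≤1+N = m≤n⇒m≤1+n (m≤m+n b₄ (t + t))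

  b₅≤1+N : b₅ ≤ suc N
  b₅≤1+N = s≤s (m≤m+n b₄ (t + t))

  countIn-[1,b₃⟩ : ∀ S → countIn 1 b₁ S + countIn b₁ b₂ S + countIn b₂ b₃ S ≡ countIn 1 b₃ S
  countIn-[1,b₃⟩ S = trans (cong (_+ countIn b₂ b₃ S) (countIn-split 1≤b₁ b₁≤b₂ S))
                           (countIn-split (≤-trans 1≤b₁ b₁≤b₂) b₂≤b₃ S)

  countIn-[1,N] : ∀ S → countIn 1 b₃ S + countIn b₃ b₄ S + countIn b₄ (suc N) S ≡ countIn 1 (suc N) S
  countIn-[1,N] S = trans (cong (_+ countIn b₄ (suc N) S) (countIn-split 1≤b₃ b₃≤b₄ S))
                          (countIn-split (≤-trans 1≤b₃ b₃≤b₄) b₄≤1+N S)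
    where
    1≤b₃ : 1 ≤ b₃
    1≤b₃ = ≤-trans 1≤b₁ (≤-trans b₁≤b₂ b₂≤b₃)

  module Refute {x y : ℕ} {xs ys : List ℕ}
    (S₁↑ : Linked _<_ (x ∷ xs)) (S₁⊆ : All (InRange 1 (suc N)) (x ∷ xs))
    (S₂↑ : Linked _<_ (y ∷ ys)) (S₂⊆ : All (InRange 1 (suc N)) (y ∷ ys))
    (zs₁ : ZeroSumMod Δ s (x ∷ xs)) (zs₂ : ZeroSumMod Δ r (y ∷ ys))
    (|S₁| : length (x ∷ xs) ≡ s) (|S₂| : length (y ∷ ys) ≡ r)
    (M₁<y : maxL (x ∷ xs) < y) (diam≤ : diam (x ∷ xs) ≤ diam (y ∷ ys))
    where

    S₁ S₂ : List ℕ
    S₁ = x ∷ xs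
    S₂ = y ∷ ys

    M₁ M₂ : ℕ
    M₁ = maxL S₁
    M₂ = maxL S₂

    #₁ : ℕ → ℕ → ℕ
    #₁ a b = countIn a b S₁

    total₁ : #₁ 1 (suc N) ≡ s
    total₁ = trans (countIn-all S₁ S₁⊆) |S₁|

    total₂ : countIn 1 (suc N) S₂ ≡ r
    total₂ = trans (countIn-all S₂ S₂⊆) |S₂|

    M₂≤N : M₂ ≤ N
    M₂≤N = ≤-pred (proj₂ (All-maxL y ys S₂⊆))

    y+r′≤M₂ : y + r′ ≤ M₂
    y+r′≤M₂ = subst (λ l → y + l ≤ M₂) (suc-injective |S₂|) (head+length≤maxL y ys S₂↑)

    partition₁ : #₁ 1 b₁ + #₁ b₁ b₂ + #₁ b₂ b₃ + #₁ b₃ b₄ + #₁ b₄ (suc N) ≡ s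
    partition₁ = begin
      #₁ 1 b₁ + #₁ b₁ b₂ + #₁ b₂ b₃ + #₁ b₃ b₄ + #₁ b₄ (suc N)
        ≡⟨ cong (λ k → k + #₁ b₃ b₄ + #₁ b₄ (suc N)) (countIn-[1,b₃⟩ S₁) ⟩
      #₁ 1 b₃ + #₁ b₃ b₄ + #₁ b₄ (suc N) ≡⟨ countIn-[1,N] S₁ ⟩
      #₁ 1 (suc N)                       ≡⟨ total₁ ⟩
      s                                  ∎
      where open ≡-Reasoning

    block≤t : ∀ a → #₁ a (a + t) ≤ t
    block≤t a = +-cancelˡ-≤ a _ _ (countIn-bound (m≤m+n a t) S₁ S₁↑)

    #r-cases : #r S₁ ≡ 0 ⊎ #r S₁ ≡ s
    #r-cases = divisor-of-small (coprime-summand (Coprimality.sym r⊥s) s∣) #r≤s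
      where
      s∣ : s ∣ r * #r S₁ + s * #s S₁
      s∣ = subst (ℤ.+ s ℤ∣.∣_) (sumΔ-colour S₁) zs₁
      #r≤s : #r S₁ ≤ s
      #r≤s = ≤-trans (m≤m+n (#r S₁) (#₁ 1 b₁ + #₁ b₂ b₃ + #₁ b₄ (suc N)))
                     (≤-reflexive (trans (regroup (#₁ 1 b₁) (#₁ b₁ b₂) (#₁ b₂ b₃) (#₁ b₃ b₄) (#₁ b₄ (suc N)))
                                         partition₁))
        where
        regroup : ∀ z₁ a₁ z₂ a₂ h → a₁ + a₂ + (z₁ + z₂ + h) ≡ z₁ + a₁ + z₂ + a₂ + h
        regroup = solve-∀

    #s-cases : #s S₂ ≡ 0 ⊎ #s S₂ ≡ r
    #s-cases = divisor-of-small (coprime-summand r⊥s r∣) #s≤r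
      where
      r∣ : r ∣ s * #s S₂ + r * #r S₂
      r∣ = subst (r ∣_) (+-comm (r * #r S₂) _) (subst (ℤ.+ r ℤ∣.∣_) (sumΔ-colour S₂) zs₂)
      #s≤r : #s S₂ ≤ r
      #s≤r = ≤-trans (m≤n+m _ (countIn 1 b₅ S₂))
                     (≤-reflexive (trans (countIn-split (s≤s z≤n) b₅≤1+N S₂) total₂))

    M₂<b₅ : #s S₂ ≡ 0 → M₂ < b₅
    M₂<b₅ #s≡0 with <-≤-connex M₂ b₅
    ... | inj₁ M₂<b₅ = M₂<b₅
    ... | inj₂ b₅≤M₂ =
      contradiction (subst (1 ≤_) #s≡0 (countIn-∈ (maxL∈ y ys) (b₅≤M₂ , s≤s M₂≤N))) λ ()

    b₅≤y : #s S₂ ≡ r → b₅ ≤ y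
    b₅≤y #s≡r with <-≤-connex y b₅
    ... | inj₂ b₅≤y = b₅≤y
    ... | inj₁ y<b₅ = contradiction (begin-strict
      r                                ≡⟨ #s≡r ⟨
      #s S₂                            <⟨ m<n+m (#s S₂) (countIn-∈ {xs = S₂} (here refl) y∈[1,b₅⟩) ⟩
      countIn 1 b₅ S₂ + #s S₂           ≡⟨ countIn-split (s≤s z≤n) b₅≤1+N S₂ ⟩
      countIn 1 (suc N) S₂             ≡⟨ total₂ ⟩
      r                                ∎) (n≮n r)
      where
      open ≤-Reasoning
      y∈[1,b₅⟩ : InRange 1 b₅ y
      y∈[1,b₅⟩ = proj₁ (All.head S₂⊆) , y<b₅

    wide : ∀ {a b d} → 1 ≤ #₁ a b → 1 ≤ #₁ (b + t) d → #₁ a b + #₁ (b + t) d ≡ s → x + (t + t) ≤ M₁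
    wide {a} {b} {d} low high k₁+k₂≡s = ≤-pred (begin
      suc (x + (t + t))          ≡⟨ regroup x t ⟩
      x + t + s                  ≡⟨ cong (x + t +_) k₁+k₂≡s ⟨
      x + t + (k₁ + k₂)          ≡⟨ regroup′ x t k₁ k₂ ⟩
      x + k₁ + t + k₂            ≤⟨ straddle x xs S₁↑ low high ⟩
      suc M₁                     ∎)
      where
      open ≤-Reasoning
      k₁ k₂ : ℕ
      k₁ = #₁ a b
      k₂ = #₁ (b + t) d
      regroup : ∀ x t → suc (x + (t + t)) ≡ x + t + suc t
      regroup = solve-∀
      regroup′ : ∀ x t k₁ k₂ → x + t + (k₁ + k₂) ≡ x + k₁ + t + k₂
      regroup′ = solve-∀

    wide⇒⊥ : x + (t + t) ≤ M₁ → ⊥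
    wide⇒⊥ x+2t≤M₁ =
      [ (λ #s≡0 → <⇒≱ (M₂<b₅ #s≡0) b₅≤M₂) , (λ #s≡r → <⇒≱ (s≤s M₂≤N) (1+N≤M₂ #s≡r)) ]′ #s-cases
      where
      open ≤-Reasoning
      y+2t≤M₂ : y + (t + t) ≤ M₂
      y+2t≤M₂ = diam-transfer {xs = xs} {ys = ys} (head≤maxL y ys S₂↑) diam≤ x+2t≤M₁
      b₅≤M₂ : b₅ ≤ M₂
      b₅≤M₂ = begin
        b₅                         ≡⟨ regroup t ⟩
        suc (suc (t + t)) + (t + t) ≤⟨ +-monoˡ-≤ (t + t) (≤-trans (s≤s 1+2t≤M₁) M₁<y) ⟩
        y + (t + t)                ≤⟨ y+2t≤M₂ ⟩
        M₂                         ∎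
        where
        regroup : ∀ t → suc (suc t + t + t + t) ≡ suc (suc (t + t)) + (t + t)
        regroup = solve-∀
        1+2t≤M₁ : suc (t + t) ≤ M₁
        1+2t≤M₁ = ≤-trans (+-monoˡ-≤ (t + t) (proj₁ (All.head S₁⊆))) x+2t≤M₁
      1+N≤M₂ : #s S₂ ≡ r → suc N ≤ M₂
      1+N≤M₂ #s≡r = ≤-trans (+-monoˡ-≤ (t + t) (b₅≤y #s≡r)) y+2t≤M₂

    #r≡s⇒⊥ : #r S₁ ≡ s → ⊥
    #r≡s⇒⊥ #r≡s = wide⇒⊥ (wide {b₁} {b₂} {b₄} (proj₁ positive) (proj₂ positive) #r≡s)
      where
      positive : 1 ≤ #₁ b₁ b₂ × 1 ≤ #₁ b₃ b₄
      positive = both-positive (block≤t b₁) (block≤t b₃) #r≡s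

    low+high : #r S₁ ≡ 0 → #₁ 1 b₃ + #₁ b₄ (suc N) ≡ s
    low+high #r≡0 = trans (cong (_+ #₁ b₄ (suc N)) (sym (trans (cong (#₁ 1 b₃ +_) a₂≡0) (+-identityʳ _))))
                          (trans (countIn-[1,N] S₁) total₁)
      where
      a₂≡0 : #₁ b₃ b₄ ≡ 0
      a₂≡0 = m+n≡0⇒n≡0 (#₁ b₁ b₂) #r≡0

    low-split : #r S₁ ≡ 0 → #₁ 1 b₁ + #₁ b₂ b₃ ≡ #₁ 1 b₃
    low-split #r≡0 = trans (cong (_+ #₁ b₂ b₃) (sym (trans (cong (#₁ 1 b₁ +_) a₁≡0) (+-identityʳ _))))
                           (countIn-[1,b₃⟩ S₁)
      where
      a₁≡0 : #₁ b₁ b₂ ≡ 0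
      a₁≡0 = m+n≡0⇒m≡0 (#₁ b₁ b₂) #r≡0

    only-low⇒⊥ : #r S₁ ≡ 0 → #₁ b₄ (suc N) ≡ 0 → ⊥
    only-low⇒⊥ #r≡0 h≡0 = wide⇒⊥ (wide {1} {b₁} {b₃} (proj₁ positive) (proj₂ positive) z₁+z₂≡s)
      where
      z₁+z₂≡s : #₁ 1 b₁ + #₁ b₂ b₃ ≡ s
      z₁+z₂≡s = trans (low-split #r≡0)
                      (trans (sym (+-identityʳ _)) (trans (cong (#₁ 1 b₃ +_) (sym h≡0)) (low+high #r≡0)))
      positive : 1 ≤ #₁ 1 b₁ × 1 ≤ #₁ b₂ b₃
      positive = both-positive (block≤t 1) (block≤t b₂) z₁+z₂≡s

    some-high⇒⊥ : #r S₁ ≡ 0 → 1 ≤ #₁ b₄ (suc N) → ⊥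
    some-high⇒⊥ #r≡0 h≥1 = [ S₂-low⇒⊥ , S₂-high⇒⊥ ]′ #s-cases
      where
      b₄+h≤y : b₄ + #₁ b₄ (suc N) ≤ y
      b₄+h≤y = ≤-trans (countIn-max x xs S₁↑ h≥1) M₁<y
      S₂-low⇒⊥ : #s S₂ ≡ 0 → ⊥
      S₂-low⇒⊥ #s≡0 = <⇒≱ (M₂<b₅ #s≡0) (≤-trans (≤-trans b₅≤b₄+h b₄+h≤y) (head≤maxL y ys S₂↑))
        where
        b₅≤b₄+h : b₅ ≤ b₄ + #₁ b₄ (suc N)
        b₅≤b₄+h = subst (_≤ b₄ + #₁ b₄ (suc N)) (+-comm b₄ 1) (+-monoʳ-≤ b₄ h≥1)
      S₂-high⇒⊥ : #s S₂ ≡ r → ⊥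
      S₂-high⇒⊥ #s≡r with <-≤-connex (#₁ 1 b₃) 1
      ... | inj₂ low≥1 = wide⇒⊥ (wide {1} {b₃} {suc N} low≥1 h≥1 (low+high #r≡0))
      ... | inj₁ low<1 = <⇒≱ (s≤s M₂≤N) (begin
        suc N                  ≡⟨ regroup t ⟩
        b₄ + s + t             ≤⟨ +-mono-≤ (≤-trans (≤-reflexive (cong (b₄ +_) h≡s)) b₄+h≤y) t≤r′ ⟩
        y + r′                 ≤⟨ y+r′≤M₂ ⟩
        M₂                     ∎)
        where
        open ≤-Reasoning
        h≡s : s ≡ #₁ b₄ (suc N)
        h≡s = sym (trans (cong (_+ #₁ b₄ (suc N)) (sym (n<1⇒n≡0 low<1))) (low+high #r≡0))
        regroup : ∀ t → suc (suc t + t + t + t + (t + t)) ≡ suc t + t + t + t + suc t + t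
        regroup = solve-∀

    #r≡0⇒⊥ : #r S₁ ≡ 0 → ⊥
    #r≡0⇒⊥ #r≡0 with <-≤-connex (#₁ b₄ (suc N)) 1
    ... | inj₁ h<1 = only-low⇒⊥ #r≡0 (n<1⇒n≡0 h<1)
    ... | inj₂ h≥1 = some-high⇒⊥ #r≡0 h≥1

    refuted : ⊥
    refuted = [ #r≡0⇒⊥ , #r≡s⇒⊥ ]′ #r-cases

  lower : ¬ Good s r N
  lower good with good Δ
  ... | [] , _ , _ , _ , _ , _ , () , _
  ... | _ ∷ _ , [] , _ , _ , _ , _ , _ , () , _
  ... | x ∷ xs , y ∷ ys , (S₁↑ , S₁⊆) , (S₂↑ , S₂⊆) , zs₁ , zs₂ , |S₁| , |S₂| , M₁<y , diam≤ =
    Refute.refuted S₁↑ (within S₁⊆) S₂↑ (within S₂⊆) zs₁ zs₂ |S₁| |S₂| M₁<y diam≤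
    where
    within : ∀ {S} → All (λ z → 1 ≤ z × z ≤ N) S → All (InRange 1 (suc N)) S
    within = All.map λ (1≤z , z≤N) → 1≤z , s≤s z≤N

Good-mono : ∀ {s r m n} → m ≤ n → Good s r m → Good s r n
Good-mono {m = m} {n} m≤n good Δ with good Δ
... | S₁ , S₂ , (S₁↑ , S₁⊆) , (S₂↑ , S₂⊆) , rest = S₁ , S₂ , (S₁↑ , widen S₁⊆) , (S₂↑ , widen S₂⊆) , rest
  where
  widen : ∀ {S} → All (λ z → 1 ≤ z × z ≤ m) S → All (λ z → 1 ≤ z × z ≤ n) S
  widen = All.map λ (1≤z , z≤m) → 1≤z , ≤-trans z≤m m≤n

6s-4≡6t+2 : ∀ t → 6 * suc t ∸ 4 ≡ suc (suc t + t + t + t + (t + t))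
6s-4≡6t+2 t = trans (cong (_∸ 4) (6s≡4+[6t+2] t)) (m+n∸m≡n 4 _)
  where
  6s≡4+[6t+2] : ∀ t → 6 * suc t ≡ 4 + suc (suc t + t + t + t + (t + t))
  6s≡4+[6t+2] = solve-∀

2s-2≡2t : ∀ t → 2 * suc t ∸ 2 ≡ t + t
2s-2≡2t t = trans (cong (_∸ 2) (2s≡2+2t t)) (m+n∸m≡n 2 _)
  where
  2s≡2+2t : ∀ t → 2 * suc t ≡ 2 + (t + t)
  2s≡2+2t = solve-∀

theorem3p3 : (r s : ℕ) → 3 ≤ s → s ≤ r → gcd r s ≡ 1 → r ≤ 2 * s ∸ 2 →
    fZ≡ s r (6 * s ∸ 4)
theorem3p3 zero     (suc t) _   ()  _     _
theorem3p3 (suc r′) (suc t) 3≤s s≤r gcd≡1 r≤2s-2 =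
  subst (1 ≤_) (sym (6s-4≡6t+2 t)) (s≤s z≤n) ,
  subst (Good (suc t) (suc r′)) (trans N≡6t+2 (sym (6s-4≡6t+2 t))) (UpperBound.upper t r′ c r′+c≡t+t 1≤r′) ,
  λ n _ n<6s-4 → LowerBound.lower t r′ t≤r′ (gcd≡1⇒coprime gcd≡1)
                ∘ Good-mono (≤-pred (subst (n <_) (6s-4≡6t+2 t) n<6s-4))
  where
  t≤r′ : t ≤ r′
  t≤r′ = ≤-pred s≤r
  1≤r′ : 1 ≤ r′
  1≤r′ = ≤-trans (s≤s z≤n) (≤-trans (≤-pred 3≤s) t≤r′)
  c : ℕ
  c = t + t ∸ r′
  r′+c≡t+t : r′ + c ≡ t + t
  r′+c≡t+t = m+[n∸m]≡n (≤-trans (n≤1+n r′) (subst (suc r′ ≤_) (2s-2≡2t t) r≤2s-2))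
  N≡6t+2 : UpperBound.N t r′ c r′+c≡t+t 1≤r′ ≡ suc (suc t + t + t + t + (t + t))
  N≡6t+2 = trans (cong (λ k → suc t + suc t + k + k) r′+c≡t+t) (regroup t)
    where
    regroup : ∀ t → suc t + suc t + (t + t) + (t + t) ≡ suc (suc t + t + t + t + (t + t))
    regroup = solve-∀
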